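{- Let $f_0(x),f_1(x)\in\mathbb{C}[x]$ be nonzero polynomials with $\deg(f_0)>\deg(f_1)$, let $\{f_i(x)\}_{i=0}^{s+1}$ be their generalized Sturm sequence with quotients $B_i$, $m_i=\deg(B_i)$ and $b_i$ the leading coefficient of $B_i$ ($0\le i\le s-1$), and let $S_{f_0,f_1}(x)=x^{m_0-1}\overleftarrow{f_1}(x)/\overleftarrow{f_0}(x)$ as a formal power series. Let $0\le\kappa\le s-1$ and $r=m_0+m_1+\cdots+m_{\kappa-1}$, and suppose $H_r(S_{f_0,f_1})\neq0$. Then $H_t(S_{f_0,f_1})=0$ for all $r<t<r+m_\kappa$, and $$H_{r+m_\kappa}(S_{f_0,f_1})=(-1)^{\frac{m_\kappa(m_\kappa-1)}{2}}\Big(b_\kappa\prod_{i=0}^{\kappa-1}b_i^2\Big)^{ -m_\kappa}H_r(S_{f_0,f_1}),$$ with the initial condition $H_0(S_{f_0,f_1})=1$.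
   Context: Generalized Sturm sequence: given nonzero $f_0,f_1\in\mathbb{C}[x]$ with $\deg(f_0)>\deg(f_1)$, define recursively $f_{i+2}=-\mathrm{rem}(f_i,f_{i+1})$ (minus the remainder of division of $f_i$ by $f_{i+1}$) as long as $f_{i+1}\neq0$; $s$ is the index with $f_s\neq0$, $f_{s+1}=0$. Quotients $B_i$ satisfy $f_i=B_if_{i+1}-f_{i+2}$ for $0\le i\le s-1$. Reversal: $\overleftarrow{f}(x)=x^{\deg f}f(x^{ -1})$. For a power series $F=\sum_{i\ge0}h_ix^i$, $H_n(F)=\det(h_{i+j})_{0\le i,j\le n-1}$ and $H_0(F)=1$. -}

module Defs where

open import Level using (Level; _⊔_)
open import Algebra.Bundles using (CommutativeRing)
open import Data.Nat as ℕ using (ℕ; zero; suc; _≤?_; _∸_)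
open import Data.Fin using (Fin; zero; suc; toℕ; punchIn)
open import Data.Product using (_×_)
open import Relation.Nullary using (¬_; yes; no)

-- A field: a commutative ring with 0 ≉ 1 and a (total) inverse operation
-- that is a genuine inverse on nonzero elements (value at 0 unspecified).
record Field (c ℓ : Level) : Set (Level.suc (c ⊔ ℓ)) where
  field
    commutativeRing : CommutativeRing c ℓ
  open CommutativeRing commutativeRing public
  field
    _⁻¹       : Carrier → Carrier
    ⁻¹-cong   : ∀ {x y} → x ≈ y → (x ⁻¹) ≈ (y ⁻¹)
    0≉1       : ¬ (0# ≈ 1#)
    ⁻¹-inverse : ∀ x → ¬ (x ≈ 0#) → (x * (x ⁻¹)) ≈ 1#

sumℕ : ℕ → (ℕ → ℕ) → ℕ
sumℕ zero    g = 0
sumℕ (suc n) g = sumℕ n g ℕ.+ g n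

module FieldDefs {c ℓ} (F : Field c ℓ) where
  open Field F hiding (zero)

  sumUpTo : ℕ → (ℕ → Carrier) → Carrier
  sumUpTo zero    g = 0#
  sumUpTo (suc n) g = sumUpTo n g + g n

  prodUpTo : ℕ → (ℕ → Carrier) → Carrier
  prodUpTo zero    g = 1#
  prodUpTo (suc n) g = prodUpTo n g * g n

  pow : Carrier → ℕ → Carrier
  pow x zero    = 1#
  pow x (suc n) = pow x n * x

  -- Polynomials / power series are represented by coefficient functions
  -- ℕ → Carrier  (k ↦ coefficient of x^k).
  -- Cauchy product: coefficient k of P·Q.
  conv : (ℕ → Carrier) → (ℕ → Carrier) → ℕ → Carrier
  conv P Q k = sumUpTo (suc k) (λ j → P j * Q (k ∸ j))

  HasDegree : (ℕ → Carrier) → ℕ → Set ℓ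
  HasDegree p n = (¬ (p n ≈ 0#)) × (∀ k → n ℕ.< k → p k ≈ 0#)

  rev : (ℕ → Carrier) → ℕ → ℕ → Carrier
  rev p n k with k ≤? n
  ... | yes _ = p (n ∸ k)
  ... | no  _ = 0#

  shift : ℕ → (ℕ → Carrier) → ℕ → Carrier
  shift e p k with e ≤? k
  ... | yes _ = p (k ∸ e)
  ... | no  _ = 0#

  sumFin : ∀ n → (Fin n → Carrier) → Carrier
  sumFin zero    g = 0#
  sumFin (suc n) g = g zero + sumFin n (λ j → g (suc j))

  signFin : ∀ {n} → Fin n → Carrier
  signFin zero    = 1#
  signFin (suc j) = - signFin j

  det : ∀ n → (Fin n → Fin n → Carrier) → Carrier
  det zero    M = 1#
  det (suc n) M =
    sumFin (suc n) (λ j → signFin j * (M zero j * det n (λ i k → M (suc i) (punchIn j k))))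

  hankel : ℕ → (ℕ → Carrier) → Carrier
  hankel n h = det n (λ i j → h (toℕ i ℕ.+ toℕ j))

  -- Generalized Sturm sequence f_0,…,f_{s+1} (f i k = coefficient of x^k in f_i,
  -- d i = deg f_i) with quotients B_i (B i k = coeff., m i = deg B_i), i < s.
  -- f_{i+2} = - rem(f_i , f_{i+1}) is encoded by the defining property of
  -- division with remainder: f_i = B_i f_{i+1} - f_{i+2}, deg f_{i+2} < deg f_{i+1}
  -- (or f_{i+2} = 0), which determines B_i and f_{i+2} uniquely.
  record IsGenSturm (s : ℕ) (f : ℕ → ℕ → Carrier) (d : ℕ → ℕ)
                    (B : ℕ → ℕ → Carrier) (m : ℕ → ℕ) : Set (c ⊔ ℓ) where
    field
      f-deg   : ∀ i → i ℕ.≤ s → HasDegree (f i) (d i)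
      f-last  : ∀ k → f (suc s) k ≈ 0#
      deg-dec : ∀ i → i ℕ.< s → d (suc i) ℕ.< d i
      B-deg   : ∀ i → i ℕ.< s → HasDegree (B i) (m i)
      recur   : ∀ i → i ℕ.< s → ∀ k →
                f i k ≈ (conv (B i) (f (suc i)) k - f (suc (suc i)) k)

-- Notation used in the statement: field operations (multiplication written _·_
-- to avoid clashing with ℕ's _*_) together with the definitions above.
module FieldNotation {c ℓ} (F : Field c ℓ) where
  open Field F public using (Carrier; _≈_; 0#; 1#; -_; _⁻¹) renaming (_*_ to _·_)
  open FieldDefs F public

-- Write S_i for the series S_{f_i,f_{i+1}} and b_i for the leading coefficient of B_i.
-- Reversing f_i = B_i f_{i+1} − f_{i+2} gives rev(B_i)·S_i = x^(m_i−1) + x^(m_i+1)·S_i·S_{i+1}.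
-- On the Hankel matrix of S_i this identity is a lower-triangular row operation (diagonal 1 on
-- the first m_i rows, b_i on the others) producing a block-triangular matrix: its upper-left
-- m_i × m_i block is anti-triangular with anti-diagonal S_i[m_i−1] = 1/b_i, and its lower-right
-- block is a triangular transform of the Hankel matrix of S_{i+1}. Hence
-- H_{m_i+n}(S_i)·b_i^(2n) = H_{m_i}(S_i)·H_n(S_{i+1}), with H_{m_i}(S_i) = (−1)^(m_i(m_i−1)/2)·b_i^(−m_i).
-- Chaining these identities along the Sturm sequence gives H_{r+t}(S_0)·∏_{i<κ} b_i^(2t) =
-- H_r(S_0)·H_t(S_κ), and both claims follow from the first m_κ Hankel determinants of S_κ:
-- they vanish below m_κ, and the m_κ-th is (−1)^(m_κ(m_κ−1)/2)·b_κ^(−m_κ).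

module Submission where

open import Defs
open import Level using (Level)
open import Data.Nat using (ℕ; suc; _+_; _*_; _∸_; _/_; _<_)
open import Data.Product using (_×_)
open import Relation.Nullary using (¬_)

open import Data.Nat as ℕ using (zero; _≤_; z≤n; s≤s; _≤?_; _<?_; _≟_)
import Data.Nat.Properties as ℕₚ
open import Level using (_⊔_)
open import Data.Nat.Solver using (module +-*-Solver)
import Data.Nat.DivMod as ℕ/
open import Data.Nat.Divisibility using (divides)
open import Data.Fin as Fin using (Fin; toℕ)
open import Data.Empty using (⊥-elim)
open import Function using (_∘_)
open import Data.Product using (∃-syntax; _,_; proj₁; proj₂)
open import Relation.Nullary using (yes; no)
open import Relation.Binary.Definitions using (tri<; tri≈; tri>)
open import Relation.Binary.PropositionalEquality as ≡ using (_≡_; _≢_)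
import Algebra.Solver.Ring.NaturalCoefficients.Default as SemiringSolver
import Algebra.Properties.Ring as RingProperties
import Algebra.Properties.CommutativeSemigroup as CommutativeSemigroupProperties
import Algebra.Properties.Group as GroupProperties
import Algebra.Properties.AbelianGroup as AbelianGroupProperties
import Relation.Binary.Reasoning.Setoid as SetoidReasoning

<∸1⇒suc< : ∀ {a m} → a < m ∸ 1 → suc a < m
<∸1⇒suc< {m = suc m} a<m = s≤s a<m

<⇒≤∸1 : ∀ {a m} → a < m → a ≤ m ∸ 1
<⇒≤∸1 {m = suc m} (s≤s a≤m) = a≤m

suc<⇒<∸1 : ∀ {a m} → suc a < m → a < m ∸ 1
suc<⇒<∸1 {m = suc m} (s≤s a<m) = a<m

m+o∸[m∸n]≡n+o : ∀ {m n} o → n ≤ m → m + o ∸ (m ∸ n) ≡ n + o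
m+o∸[m∸n]≡n+o {m} {n} o n≤m = begin
  m + o ∸ (m ∸ n)                 ≡⟨ ≡.cong (λ k → k + o ∸ (m ∸ n)) (ℕₚ.m+[n∸m]≡n n≤m) ⟨
  n + (m ∸ n) + o ∸ (m ∸ n)       ≡⟨ ≡.cong (_∸ (m ∸ n)) (solve 3 (λ x y z → (x :+ y) :+ z := y :+ (x :+ z)) ≡.refl n (m ∸ n) o) ⟩
  (m ∸ n) + (n + o) ∸ (m ∸ n)     ≡⟨ ℕₚ.m+n∸m≡n (m ∸ n) (n + o) ⟩
  n + o                           ∎
  where
  open ≡.≡-Reasoning
  open +-*-Solver using (solve; _:+_; _:=_)

m+n≡1+m+[n∸1] : ∀ a {b} → 0 < b → a + b ≡ suc a + (b ∸ 1)
m+n≡1+m+[n∸1] a {suc b} _ = ℕₚ.+-suc a b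

[m∸1]+1+n≡m+n : ∀ {a} b → 0 < a → a ∸ 1 + suc b ≡ a + b
[m∸1]+1+n≡m+n {suc a} b _ = ℕₚ.+-suc a b

triangular-suc : ∀ m → (suc m * m) / 2 ≡ (m * (m ∸ 1)) / 2 + m
triangular-suc zero    = ≡.refl
triangular-suc (suc k) = begin
  (suc (suc k) * suc k) / 2
    ≡⟨ ≡.cong (_/ 2) (solve 1 (λ k → (con 2 :+ k) :* (con 1 :+ k) := (con 1 :+ k) :* k :+ (con 1 :+ k) :* con 2) ≡.refl k) ⟩
  (suc k * k + suc k * 2) / 2        ≡⟨ ℕ/.+-distrib-/-∣ʳ (suc k * k) (divides (suc k) ≡.refl) ⟩
  (suc k * k) / 2 + (suc k * 2) / 2  ≡⟨ ≡.cong ((suc k * k) / 2 +_) (ℕ/.m*n/n≡m (suc k) 2) ⟩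
  (suc k * k) / 2 + suc k            ∎
  where
  open ≡.≡-Reasoning
  open +-*-Solver using (solve; _:+_; _:*_; _:=_; con)

m∸1<m : ∀ {m} → 0 < m → m ∸ 1 < m
m∸1<m {suc m} _ = ℕₚ.n<1+n m

module OverField {ℓ₁ ℓ₂} (F : Field ℓ₁ ℓ₂) where

  open Field F public hiding (zero)
    renaming (_+_ to _⊕_; _*_ to _·_; _-_ to _⊖_)
  open FieldDefs F public
  open SetoidReasoning setoid
  open RingProperties ring using (-‿distribˡ-*; -‿distribʳ-*)
  open CommutativeSemigroupProperties *-commutativeSemigroup using (interchange; xy∙z≈xz∙y)
  open GroupProperties +-group using (⁻¹-involutive; ε⁻¹≈ε; x∙y⁻¹≈ε⇒x≈y)
  open AbelianGroupProperties +-abelianGroup using (⁻¹-∙-comm)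
  open SemiringSolver commutativeSemiring using (solve; _:+_; _:*_; _:=_)

  Series : Set ℓ₁
  Series = ℕ → Carrier

  x·y≈0⇒x≈0 : ∀ {x y} → y ≉ 0# → x · y ≈ 0# → x ≈ 0#
  x·y≈0⇒x≈0 {x} {y} y≉0 xy≈0 = begin
    x                 ≈⟨ *-identityʳ x ⟨
    x · 1#            ≈⟨ *-congˡ (⁻¹-inverse y y≉0) ⟨
    x · (y · y ⁻¹)    ≈⟨ *-assoc x y (y ⁻¹) ⟨
    (x · y) · y ⁻¹    ≈⟨ *-congʳ xy≈0 ⟩
    0# · y ⁻¹         ≈⟨ zeroˡ _ ⟩
    0#                ∎

  ·-nonZero : ∀ {x y} → x ≉ 0# → y ≉ 0# → x · y ≉ 0#
  ·-nonZero x≉0 y≉0 xy≈0 = x≉0 (x·y≈0⇒x≈0 y≉0 xy≈0)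

  ·-cancelʳ : ∀ {x y z} → z ≉ 0# → x · z ≈ y · z → x ≈ y
  ·-cancelʳ {x} {y} {z} z≉0 xz≈yz = x∙y⁻¹≈ε⇒x≈y x y (x·y≈0⇒x≈0 z≉0 (begin
    (x ⊖ y) · z         ≈⟨ distribʳ z x (- y) ⟩
    x · z ⊕ (- y) · z   ≈⟨ +-cong xz≈yz (sym (-‿distribˡ-* y z)) ⟩
    y · z ⊖ y · z       ≈⟨ -‿inverseʳ _ ⟩
    0#                  ∎))

  1≉0 : 1# ≉ 0#
  1≉0 1≈0 = 0≉1 (sym 1≈0)

  pow-cong : ∀ {x y} n → x ≈ y → pow x n ≈ pow y n
  pow-cong zero    x≈y = refl
  pow-cong (suc n) x≈y = *-cong (pow-cong n x≈y) x≈y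

  pow-+ : ∀ x a b → pow x (a + b) ≈ pow x a · pow x b
  pow-+ x zero    b = sym (*-identityˡ _)
  pow-+ x (suc a) b = begin
    pow x (a + b) · x          ≈⟨ *-congʳ (pow-+ x a b) ⟩
    (pow x a · pow x b) · x    ≈⟨ xy∙z≈xz∙y _ _ _ ⟩
    (pow x a · x) · pow x b    ∎

  pow-distrib-· : ∀ x y n → pow (x · y) n ≈ pow x n · pow y n
  pow-distrib-· x y zero    = sym (*-identityˡ _)
  pow-distrib-· x y (suc n) = trans (*-congʳ (pow-distrib-· x y n)) (interchange _ _ _ _)

  pow-1# : ∀ n → pow 1# n ≈ 1#
  pow-1# zero    = refl
  pow-1# (suc n) = trans (*-identityʳ _) (pow-1# n)

  pow-nonZero : ∀ {x} n → x ≉ 0# → pow x n ≉ 0#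
  pow-nonZero zero    x≉0 = 1≉0
  pow-nonZero (suc n) x≉0 = ·-nonZero (pow-nonZero n x≉0) x≉0

  pow-inverse : ∀ {x y} n → x · y ≈ 1# → pow x n · pow y n ≈ 1#
  pow-inverse {x} {y} n xy≈1 = trans (sym (pow-distrib-· x y n)) (trans (pow-cong n xy≈1) (pow-1# n))

  -- Finite sums and products

  sum-cong< : ∀ n {f g : ℕ → Carrier} → (∀ j → j < n → f j ≈ g j) → sumUpTo n f ≈ sumUpTo n g
  sum-cong< zero    f≈g = refl
  sum-cong< (suc n) f≈g = +-cong (sum-cong< n (λ j j<n → f≈g j (ℕₚ.m<n⇒m<1+n j<n))) (f≈g n ℕₚ.≤-refl)

  sum-cong : ∀ n {f g : ℕ → Carrier} → (∀ j → f j ≈ g j) → sumUpTo n f ≈ sumUpTo n g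
  sum-cong n f≈g = sum-cong< n (λ j _ → f≈g j)

  sum-zero : ∀ n {f : ℕ → Carrier} → (∀ j → j < n → f j ≈ 0#) → sumUpTo n f ≈ 0#
  sum-zero zero    f≈0 = refl
  sum-zero (suc n) f≈0 =
    trans (+-cong (sum-zero n (λ j j<n → f≈0 j (ℕₚ.m<n⇒m<1+n j<n))) (f≈0 n ℕₚ.≤-refl)) (+-identityˡ 0#)

  sum-distrib-⊕ : ∀ n f g → sumUpTo n (λ j → f j ⊕ g j) ≈ sumUpTo n f ⊕ sumUpTo n g
  sum-distrib-⊕ zero    f g = sym (+-identityˡ 0#)
  sum-distrib-⊕ (suc n) f g = trans (+-congʳ (sum-distrib-⊕ n f g)) (+-interchange _ _ _ _)
    where open CommutativeSemigroupProperties +-commutativeSemigroup renaming (interchange to +-interchange)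

  -‿distrib-sum : ∀ n f → sumUpTo n (λ j → - f j) ≈ - sumUpTo n f
  -‿distrib-sum zero    f = sym ε⁻¹≈ε
  -‿distrib-sum (suc n) f = trans (+-congʳ (-‿distrib-sum n f)) (⁻¹-∙-comm _ _)

  ·-distribˡ-sum : ∀ n a f → a · sumUpTo n f ≈ sumUpTo n (λ j → a · f j)
  ·-distribˡ-sum zero    a f = zeroʳ a
  ·-distribˡ-sum (suc n) a f = trans (distribˡ a _ _) (+-congʳ (·-distribˡ-sum n a f))

  ·-distribʳ-sum : ∀ n a f → sumUpTo n f · a ≈ sumUpTo n (λ j → f j · a)
  ·-distribʳ-sum n a f =
    trans (*-comm _ a) (trans (·-distribˡ-sum n a f) (sum-cong n (λ j → *-comm a (f j))))

  sum-head : ∀ n f → sumUpTo (suc n) f ≈ f 0 ⊕ sumUpTo n (λ j → f (suc j))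
  sum-head zero    f = trans (+-identityˡ _) (sym (+-identityʳ _))
  sum-head (suc n) f = trans (+-congʳ (sum-head n f)) (+-assoc _ _ _)

  sum-+ : ∀ a b f → sumUpTo (a + b) f ≈ sumUpTo a f ⊕ sumUpTo b (λ t → f (a + t))
  sum-+ a zero    f rewrite ℕₚ.+-identityʳ a = sym (+-identityʳ _)
  sum-+ a (suc b) f rewrite ℕₚ.+-suc a b = trans (+-congʳ (sum-+ a b f)) (+-assoc _ _ _)

  sum-swap : ∀ n k (G : ℕ → ℕ → Carrier) →
             sumUpTo n (λ i → sumUpTo k (G i)) ≈ sumUpTo k (λ j → sumUpTo n (λ i → G i j))
  sum-swap zero    k G = sym (sum-zero k (λ _ _ → refl))
  sum-swap (suc n) k G = trans (+-congʳ (sum-swap n k G)) (sym (sum-distrib-⊕ k _ _))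

  sum-reverse : ∀ n f → sumUpTo n f ≈ sumUpTo n (λ j → f (n ∸ suc j))
  sum-reverse zero    f = refl
  sum-reverse (suc n) f = begin
    sumUpTo n f ⊕ f n                          ≈⟨ +-comm _ _ ⟩
    f n ⊕ sumUpTo n f                          ≈⟨ +-congˡ (sum-reverse n f) ⟩
    f n ⊕ sumUpTo n (λ j → f (n ∸ suc j))      ≈⟨ sum-head n (λ j → f (n ∸ j)) ⟨
    sumUpTo (suc n) (λ j → f (n ∸ j))          ∎

  sum-single : ∀ n f k → k < n → (∀ j → j < n → j ≢ k → f j ≈ 0#) → sumUpTo n f ≈ f k
  sum-single (suc n) f k k<1+n f≈0 with k ≟ n
  ... | yes ≡.refl =
    trans (+-congʳ (sum-zero n (λ j j<n → f≈0 j (ℕₚ.m<n⇒m<1+n j<n) (ℕₚ.<⇒≢ j<n)))) (+-identityˡ _)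
  ... | no k≢n = trans (+-cong (sum-single n f k k<n (λ j j<n → f≈0 j (ℕₚ.m<n⇒m<1+n j<n)))
                               (f≈0 n ℕₚ.≤-refl (k≢n ∘ ≡.sym)))
                       (+-identityʳ _)
    where
    k<n : k < n
    k<n = ℕₚ.≤∧≢⇒< (ℕ.s≤s⁻¹ k<1+n) k≢n

  sum-extend : ∀ {a a'} f → a ≤ a' → (∀ j → a ≤ j → j < a' → f j ≈ 0#) →
               sumUpTo a' f ≈ sumUpTo a f
  sum-extend {a} {a'} f a≤a' f≈0 = begin
    sumUpTo a' f                                      ≡⟨ ≡.cong (λ n → sumUpTo n f) (ℕₚ.m+[n∸m]≡n a≤a') ⟨
    sumUpTo (a + (a' ∸ a)) f                          ≈⟨ sum-+ a (a' ∸ a) f ⟩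
    sumUpTo a f ⊕ sumUpTo (a' ∸ a) (λ t → f (a + t))  ≈⟨ +-congˡ (sum-zero (a' ∸ a) tail≈0) ⟩
    sumUpTo a f ⊕ 0#                                  ≈⟨ +-identityʳ _ ⟩
    sumUpTo a f                                       ∎
    where
    tail≈0 : ∀ t → t < a' ∸ a → f (a + t) ≈ 0#
    tail≈0 t t<a'-a = f≈0 (a + t) (ℕₚ.m≤m+n a t) (≡.subst (a + t <_) (ℕₚ.m+[n∸m]≡n a≤a') (ℕₚ.+-monoʳ-< a t<a'-a))

  ·-distribˡ-sum₂ : ∀ n a b f → a · (b · sumUpTo n f) ≈ sumUpTo n (λ i → a · (b · f i))
  ·-distribˡ-sum₂ n a b f = trans (*-congˡ (·-distribˡ-sum n b f)) (·-distribˡ-sum n a _)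

  sum-triangle : ∀ N (G : ℕ → ℕ → Carrier) →
    sumUpTo N (λ j → sumUpTo (suc j) (λ i → G i j)) ≈ sumUpTo N (λ i → sumUpTo (N ∸ i) (λ t → G i (i + t)))
  sum-triangle zero    G = refl
  sum-triangle (suc N) G = begin
    sumUpTo N (λ j → sumUpTo (suc j) (λ i → G i j)) ⊕ (sumUpTo N (λ i → G i N) ⊕ G N N)
      ≈⟨ +-congʳ (sum-triangle N G) ⟩
    sumUpTo N (λ i → sumUpTo (N ∸ i) (λ t → G i (i + t))) ⊕ (sumUpTo N (λ i → G i N) ⊕ G N N)
      ≈⟨ +-assoc _ _ _ ⟨
    (sumUpTo N (λ i → sumUpTo (N ∸ i) (λ t → G i (i + t))) ⊕ sumUpTo N (λ i → G i N)) ⊕ G N N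
      ≈⟨ +-cong (sym (sum-distrib-⊕ N _ _)) last ⟩
    sumUpTo N (λ i → sumUpTo (N ∸ i) (λ t → G i (i + t)) ⊕ G i N) ⊕ sumUpTo (suc N ∸ N) (λ t → G N (N + t))
      ≈⟨ +-congʳ (sum-cong< N λ i i<N → trans (+-congˡ (reflexive (≡.cong (G i) (≡.sym (ℕₚ.m+[n∸m]≡n (ℕₚ.<⇒≤ i<N))))))
                                                (reflexive (≡.cong (λ k → sumUpTo k (λ t → G i (i + t))) (≡.sym (ℕₚ.+-∸-assoc 1 (ℕₚ.<⇒≤ i<N)))))) ⟩
    sumUpTo (suc N) (λ i → sumUpTo (suc N ∸ i) (λ t → G i (i + t))) ∎
    where
    last : G N N ≈ sumUpTo (suc N ∸ N) (λ t → G N (N + t))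
    last rewrite ℕₚ.+-∸-assoc 1 (ℕₚ.≤-refl {N}) | ℕₚ.n∸n≡0 N | ℕₚ.+-identityʳ N = sym (+-identityˡ _)

  sum-agree : ∀ a b f → (∀ j → b ≤ j → j < a → f j ≈ 0#) → (∀ j → a ≤ j → j < b → f j ≈ 0#) →
              sumUpTo a f ≈ sumUpTo b f
  sum-agree a b f f≈0₁ f≈0₂ with a ≤? b
  ... | yes a≤b = sym (sum-extend f a≤b f≈0₂)
  ... | no  a≰b = sum-extend f (ℕₚ.<⇒≤ (ℕₚ.≰⇒> a≰b)) f≈0₁

  prodUpTo-const : ∀ n {f x} → (∀ j → j < n → f j ≈ x) → prodUpTo n f ≈ pow x n
  prodUpTo-const zero    f≈x = refl
  prodUpTo-const (suc n) f≈x = *-cong (prodUpTo-const n (λ j j<n → f≈x j (ℕₚ.m<n⇒m<1+n j<n))) (f≈x n ℕₚ.≤-refl)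

  prodUpTo-+ : ∀ a b f → prodUpTo (a + b) f ≈ prodUpTo a f · prodUpTo b (λ t → f (a + t))
  prodUpTo-+ a zero    f rewrite ℕₚ.+-identityʳ a = sym (*-identityʳ _)
  prodUpTo-+ a (suc b) f rewrite ℕₚ.+-suc a b = trans (*-congʳ (prodUpTo-+ a b f)) (*-assoc _ _ _)

  prodUpTo-nonZero : ∀ n {f} → (∀ j → j < n → f j ≉ 0#) → prodUpTo n f ≉ 0#
  prodUpTo-nonZero zero    f≉0 = 1≉0
  prodUpTo-nonZero (suc n) f≉0 =
    ·-nonZero (prodUpTo-nonZero n (λ j j<n → f≉0 j (ℕₚ.m<n⇒m<1+n j<n))) (f≉0 n ℕₚ.≤-refl)

  sumℕ-head : ∀ κ g → sumℕ (suc κ) g ≡ g 0 + sumℕ κ (g ∘ suc)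
  sumℕ-head zero    g = ℕₚ.+-comm 0 (g 0)
  sumℕ-head (suc κ) g = ≡.trans (≡.cong (_+ g (suc κ)) (sumℕ-head κ g)) (ℕₚ.+-assoc (g 0) _ _)

  prodUpTo-head : ∀ κ g → prodUpTo (suc κ) g ≈ g 0 · prodUpTo κ (g ∘ suc)
  prodUpTo-head zero    g = trans (*-identityˡ _) (sym (*-identityʳ _))
  prodUpTo-head (suc κ) g = trans (*-congʳ (prodUpTo-head κ g)) (*-assoc _ _ _)

  -- Determinants of ℕ-indexed matrices

  sign : ℕ → Carrier
  sign n = pow (- 1#) n

  sign-suc : ∀ n → sign (suc n) ≈ - sign n
  sign-suc n = trans (sym (-‿distribʳ-* _ _)) (-‿cong (*-identityʳ _))

  Matrix : Set ℓ₁
  Matrix = ℕ → ℕ → Carrier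

  _ᵀ : Matrix → Matrix
  (M ᵀ) i j = M j i

  punchIn : ℕ → ℕ → ℕ
  punchIn zero    k       = suc k
  punchIn (suc j) zero    = zero
  punchIn (suc j) (suc k) = suc (punchIn j k)

  punchIn-< : ∀ {j k} → k < j → punchIn j k ≡ k
  punchIn-< {suc j} {zero}  _           = ≡.refl
  punchIn-< {suc j} {suc k} (s≤s k<j) = ≡.cong suc (punchIn-< k<j)

  punchIn-≥ : ∀ {j k} → j ≤ k → punchIn j k ≡ suc k
  punchIn-≥ {zero}  {k}     _           = ≡.refl
  punchIn-≥ {suc j} {suc k} (s≤s j≤k) = ≡.cong suc (punchIn-≥ j≤k)

  punchIn-bound : ∀ {n} j {k} → k < n → punchIn j k < suc n
  punchIn-bound zero            k<n       = s≤s k<n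
  punchIn-bound (suc j) {zero}  k<n       = s≤s z≤n
  punchIn-bound (suc j) {suc k} (s≤s k<n) = s≤s (punchIn-bound j k<n)

  minor : ℕ → Matrix → Matrix
  minor j M i k = M (suc i) (punchIn j k)

  minorᵀ : ℕ → Matrix → Matrix
  minorᵀ i M = minor i (M ᵀ) ᵀ

  -- Matrices are indexed by ℕ; detℕ n M only reads the entries M i j with i, j < n.
  detℕ : ℕ → Matrix → Carrier
  detℕ zero    M = 1#
  detℕ (suc n) M = sumUpTo (suc n) (λ j → sign j · (M 0 j · detℕ n (minor j M)))

  detℕ-cong< : ∀ n {M N : Matrix} → (∀ i j → i < n → j < n → M i j ≈ N i j) → detℕ n M ≈ detℕ n N
  detℕ-cong< zero    M≈N = refl
  detℕ-cong< (suc n) M≈N = sum-cong< (suc n) λ j j<1+n →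
    *-congˡ (*-cong (M≈N 0 j (s≤s z≤n) j<1+n)
                    (detℕ-cong< n λ a b a<n b<n → M≈N (suc a) _ (s≤s a<n) (punchIn-bound j b<n)))

  detℕ-cong : ∀ n {M N : Matrix} → (∀ i j → M i j ≈ N i j) → detℕ n M ≈ detℕ n N
  detℕ-cong n M≈N = detℕ-cong< n (λ i j _ _ → M≈N i j)

  toℕ-punchIn : ∀ {n} (j : Fin (suc n)) (k : Fin n) → toℕ (Fin.punchIn j k) ≡ punchIn (toℕ j) (toℕ k)
  toℕ-punchIn Fin.zero    k          = ≡.refl
  toℕ-punchIn (Fin.suc j) Fin.zero    = ≡.refl
  toℕ-punchIn (Fin.suc j) (Fin.suc k) = ≡.cong suc (toℕ-punchIn j k)

  signFin≈sign : ∀ {n} (j : Fin n) → signFin j ≈ sign (toℕ j)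
  signFin≈sign Fin.zero    = refl
  signFin≈sign (Fin.suc j) = trans (-‿cong (signFin≈sign j)) (sym (sign-suc (toℕ j)))

  sumFin≈sumUpTo : ∀ n {g : Fin n → Carrier} {G : ℕ → Carrier} → (∀ j → g j ≈ G (toℕ j)) →
                   sumFin n g ≈ sumUpTo n G
  sumFin≈sumUpTo zero    g≈G = refl
  sumFin≈sumUpTo (suc n) g≈G =
    trans (+-cong (g≈G Fin.zero) (sumFin≈sumUpTo n (g≈G ∘ Fin.suc))) (sym (sum-head n _))

  det≈detℕ : ∀ n {A : Fin n → Fin n → Carrier} {M : Matrix} → (∀ i j → A i j ≈ M (toℕ i) (toℕ j)) →
             det n A ≈ detℕ n M
  det≈detℕ zero    A≈M = refl
  det≈detℕ (suc n) {M = M} A≈M = sumFin≈sumUpTo (suc n) λ j →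
    *-cong (signFin≈sign j) (*-cong (A≈M Fin.zero j) (det≈detℕ n λ a b →
      trans (A≈M (Fin.suc a) (Fin.punchIn j b)) (reflexive (≡.cong (M (suc (toℕ a))) (toℕ-punchIn j b)))))

  Hankel : Series → Matrix
  Hankel h i j = h (i + j)

  hankel≈detℕ : ∀ n h → hankel n h ≈ detℕ n (Hankel h)
  hankel≈detℕ n h = det≈detℕ n (λ _ _ → refl)

  detℕ-expand-column₀ : ∀ n M →
    detℕ (suc n) M ≈ sumUpTo (suc n) (λ i → sign i · (M i 0 · detℕ n (minorᵀ i M)))
  detℕ-expand-column₀ zero    M = refl
  detℕ-expand-column₀ (suc n) M = begin
    detℕ (suc (suc n)) M
      ≈⟨ sum-head (suc n) _ ⟩
    t₀ ⊕ sumUpTo (suc n) (λ j → sign (suc j) · (M 0 (suc j) · detℕ (suc n) (minor (suc j) M)))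
      ≈⟨ +-congˡ (sum-cong (suc n) λ j → *-congˡ (*-congˡ (detℕ-expand-column₀ n (minor (suc j) M)))) ⟩
    t₀ ⊕ sumUpTo (suc n) (λ j → sign (suc j) · (M 0 (suc j) ·
           sumUpTo (suc n) (λ i → sign i · (M (suc i) 0 · D i j))))
      ≈⟨ +-congˡ (sum-cong (suc n) λ j → ·-distribˡ-sum₂ (suc n) _ _ _) ⟩
    t₀ ⊕ sumUpTo (suc n) (λ j → sumUpTo (suc n) (λ i →
           sign (suc j) · (M 0 (suc j) · (sign i · (M (suc i) 0 · D i j)))))
      ≈⟨ +-congˡ (sum-swap (suc n) (suc n) _) ⟩
    t₀ ⊕ sumUpTo (suc n) (λ i → sumUpTo (suc n) (λ j →
           sign (suc j) · (M 0 (suc j) · (sign i · (M (suc i) 0 · D i j)))))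
      ≈⟨ +-congˡ (sum-cong (suc n) λ i → sum-cong (suc n) λ j →
           solve 6 (λ sj s- a si b d → (sj :* s-) :* (a :* (si :* (b :* d)))
                                     := (si :* s-) :* (b :* (sj :* (a :* d))))
                   refl (sign j) (- 1#) (M 0 (suc j)) (sign i) (M (suc i) 0) (D i j)) ⟩
    t₀ ⊕ sumUpTo (suc n) (λ i → sumUpTo (suc n) (λ j →
           sign (suc i) · (M (suc i) 0 · (sign j · (M 0 (suc j) · D i j)))))
      ≈⟨ +-congˡ (sum-cong (suc n) λ i → ·-distribˡ-sum₂ (suc n) _ _ _) ⟨
    t₀ ⊕ sumUpTo (suc n) (λ i → sign (suc i) · (M (suc i) 0 · detℕ (suc n) (minorᵀ (suc i) M)))
      ≈⟨ sum-head (suc n) _ ⟨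
    sumUpTo (suc (suc n)) (λ i → sign i · (M i 0 · detℕ (suc n) (minorᵀ i M))) ∎
    where
    t₀ = sign 0 · (M 0 0 · detℕ (suc n) (minor 0 M))
    D : ℕ → ℕ → Carrier
    D i j = detℕ n (λ a b → M (suc (punchIn i a)) (suc (punchIn j b)))

  detℕ-ᵀ : ∀ n M → detℕ n (M ᵀ) ≈ detℕ n M
  detℕ-ᵀ zero    M = refl
  detℕ-ᵀ (suc n) M = begin
    detℕ (suc n) (M ᵀ)
      ≈⟨ sum-cong (suc n) (λ j → *-congˡ (*-congˡ (detℕ-ᵀ n (minorᵀ j M)))) ⟩
    sumUpTo (suc n) (λ i → sign i · (M i 0 · detℕ n (minorᵀ i M)))
      ≈⟨ detℕ-expand-column₀ n M ⟨
    detℕ (suc n) M ∎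

  detℕ-row-linear : ∀ n r → r < n → ∀ {M N P : Matrix} a b →
    (∀ i j → i ≢ r → N i j ≈ M i j) → (∀ i j → i ≢ r → P i j ≈ M i j) →
    (∀ j → M r j ≈ a · N r j ⊕ b · P r j) →
    detℕ n M ≈ a · detℕ n N ⊕ b · detℕ n P
  detℕ-row-linear (suc n) zero _ {M} {N} {P} a b N≈M P≈M row = begin
    detℕ (suc n) M
      ≈⟨ sum-cong (suc n) (λ j → *-congˡ (*-cong (row j) (detℕ-cong n λ i k → sym (N≈M (suc i) _ λ ())))) ⟩
    sumUpTo (suc n) (λ j → sign j · ((a · N 0 j ⊕ b · P 0 j) · detℕ n (minor j N)))
      ≈⟨ sum-cong (suc n) (λ j → split (sign j) (N 0 j) (P 0 j) (detℕ n (minor j N))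
                                   (detℕ-cong n λ i k → trans (P≈M (suc i) _ λ ()) (sym (N≈M (suc i) _ λ ())))) ⟩
    sumUpTo (suc n) (λ j → a · (sign j · (N 0 j · detℕ n (minor j N))) ⊕ b · (sign j · (P 0 j · detℕ n (minor j P))))
      ≈⟨ sum-distrib-⊕ (suc n) _ _ ⟩
    sumUpTo (suc n) (λ j → a · (sign j · (N 0 j · detℕ n (minor j N)))) ⊕
    sumUpTo (suc n) (λ j → b · (sign j · (P 0 j · detℕ n (minor j P))))
      ≈⟨ +-cong (·-distribˡ-sum (suc n) a _) (·-distribˡ-sum (suc n) b _) ⟨
    a · detℕ (suc n) N ⊕ b · detℕ (suc n) P ∎
    where
    split : ∀ s u v D {D'} → D' ≈ D → s · ((a · u ⊕ b · v) · D) ≈ a · (s · (u · D)) ⊕ b · (s · (v · D'))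
    split s u v D D'≈D = trans
      (solve 6 (λ s a u b v D → s :* ((a :* u :+ b :* v) :* D) := (a :* (s :* (u :* D)) :+ b :* (s :* (v :* D))))
             refl s a u b v D)
      (+-congˡ (*-congˡ (*-congˡ (*-congˡ (sym D'≈D)))))
  detℕ-row-linear (suc n) (suc r) (s≤s r<n) {M} {N} {P} a b N≈M P≈M row = begin
    detℕ (suc n) M
      ≈⟨ sum-cong (suc n) (λ j → *-congˡ (*-congˡ
           (detℕ-row-linear n r r<n a b (λ i k i≢r → N≈M (suc i) _ (i≢r ∘ ℕₚ.suc-injective))
                                        (λ i k i≢r → P≈M (suc i) _ (i≢r ∘ ℕₚ.suc-injective)) (row ∘ punchIn j)))) ⟩
    sumUpTo (suc n) (λ j → sign j · (M 0 j · (a · detℕ n (minor j N) ⊕ b · detℕ n (minor j P))))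
      ≈⟨ sum-cong (suc n) (λ j → split (sign j) (M 0 j) (sym (N≈M 0 j λ ())) (sym (P≈M 0 j λ ()))) ⟩
    sumUpTo (suc n) (λ j → a · (sign j · (N 0 j · detℕ n (minor j N))) ⊕ b · (sign j · (P 0 j · detℕ n (minor j P))))
      ≈⟨ sum-distrib-⊕ (suc n) _ _ ⟩
    sumUpTo (suc n) (λ j → a · (sign j · (N 0 j · detℕ n (minor j N)))) ⊕
    sumUpTo (suc n) (λ j → b · (sign j · (P 0 j · detℕ n (minor j P))))
      ≈⟨ +-cong (·-distribˡ-sum (suc n) a _) (·-distribˡ-sum (suc n) b _) ⟨
    a · detℕ (suc n) N ⊕ b · detℕ (suc n) P ∎
    where
    split : ∀ s m {u v x y} → m ≈ u → m ≈ v → s · (m · (a · x ⊕ b · y)) ≈ a · (s · (u · x)) ⊕ b · (s · (v · y))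
    split s m {x = x} {y} m≈u m≈v = trans
      (solve 6 (λ s m a x b y → s :* (m :* (a :* x :+ b :* y)) := (a :* (s :* (m :* x)) :+ b :* (s :* (m :* y))))
             refl s m a x b y)
      (+-cong (*-congˡ (*-congˡ (*-congʳ m≈u))) (*-congˡ (*-congˡ (*-congʳ m≈v))))

  replaceRow : ℕ → (ℕ → Carrier) → Matrix → Matrix
  replaceRow r u M i with i ≟ r
  ... | yes _ = u
  ... | no  _ = M i

  replaceRow-≡ : ∀ r u M j → replaceRow r u M r j ≡ u j
  replaceRow-≡ r u M j with r ≟ r
  ... | yes _   = ≡.refl
  ... | no r≢r = ⊥-elim (r≢r ≡.refl)

  replaceRow-≢ : ∀ {r i} u M j → i ≢ r → replaceRow r u M i j ≡ M i j
  replaceRow-≢ {r} {i} u M j i≢r with i ≟ r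
  ... | yes i≡r = ⊥-elim (i≢r i≡r)
  ... | no  _   = ≡.refl

  detℕ-replaceRow-linear : ∀ n r → r < n → ∀ M {u v w} a b → (∀ j → u j ≈ a · v j ⊕ b · w j) →
    detℕ n (replaceRow r u M) ≈ a · detℕ n (replaceRow r v M) ⊕ b · detℕ n (replaceRow r w M)
  detℕ-replaceRow-linear n r r<n M {u} {v} {w} a b u≈av+bw = detℕ-row-linear n r r<n a b
    (λ i j i≢r → reflexive (≡.trans (replaceRow-≢ v M j i≢r) (≡.sym (replaceRow-≢ u M j i≢r))))
    (λ i j i≢r → reflexive (≡.trans (replaceRow-≢ w M j i≢r) (≡.sym (replaceRow-≢ u M j i≢r))))
    (λ j → begin
      replaceRow r u M r j                                  ≡⟨ replaceRow-≡ r u M j ⟩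
      u j                                                   ≈⟨ u≈av+bw j ⟩
      a · v j ⊕ b · w j
        ≡⟨ ≡.cong₂ (λ x y → a · x ⊕ b · y) (replaceRow-≡ r v M j) (replaceRow-≡ r w M j) ⟨
      a · replaceRow r v M r j ⊕ b · replaceRow r w M r j   ∎)

  detℕ-zero-row : ∀ n r → r < n → ∀ M → detℕ n (replaceRow r (λ _ → 0#) M) ≈ 0#
  detℕ-zero-row n r r<n M = begin
    detℕ n M₀                           ≈⟨ detℕ-replaceRow-linear n r r<n M 0# 0# (λ _ → sym 0·0+0·0≈0) ⟩
    0# · detℕ n M₀ ⊕ 0# · detℕ n M₀     ≈⟨ +-cong (zeroˡ _) (zeroˡ _) ⟩
    0# ⊕ 0#                             ≈⟨ +-identityˡ 0# ⟩
    0#                                  ∎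
    where
    M₀ = replaceRow r (λ _ → 0#) M
    0·0+0·0≈0 : 0# · 0# ⊕ 0# · 0# ≈ 0#
    0·0+0·0≈0 = trans (+-cong (zeroˡ 0#) (zeroˡ 0#)) (+-identityˡ 0#)

  detℕ-row-sum : ∀ n r → r < n → ∀ M K (coeff : ℕ → Carrier) (V : ℕ → ℕ → Carrier) →
    detℕ n (replaceRow r (λ j → sumUpTo K (λ a → coeff a · V a j)) M)
      ≈ sumUpTo K (λ a → coeff a · detℕ n (replaceRow r (V a) M))
  detℕ-row-sum n r r<n M zero    coeff V = detℕ-zero-row n r r<n M
  detℕ-row-sum n r r<n M (suc K) coeff V = begin
    detℕ n (replaceRow r (λ j → sumUpTo K (λ a → coeff a · V a j) ⊕ coeff K · V K j) M)
      ≈⟨ detℕ-replaceRow-linear n r r<n M 1# (coeff K) (λ j → +-congʳ (sym (*-identityˡ _))) ⟩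
    1# · detℕ n (replaceRow r (λ j → sumUpTo K (λ a → coeff a · V a j)) M) ⊕ coeff K · detℕ n (replaceRow r (V K) M)
      ≈⟨ +-congʳ (trans (*-identityˡ _) (detℕ-row-sum n r r<n M K coeff V)) ⟩
    sumUpTo (suc K) (λ a → coeff a · detℕ n (replaceRow r (V a) M)) ∎

  swapAt : ℕ → ℕ → ℕ
  swapAt zero    zero          = 1
  swapAt zero    (suc zero)    = 0
  swapAt zero    (suc (suc k)) = suc (suc k)
  swapAt (suc c) zero          = zero
  swapAt (suc c) (suc k)       = suc (swapAt c k)

  swapAt-self : ∀ c → swapAt c c ≡ suc c
  swapAt-self zero    = ≡.refl
  swapAt-self (suc c) = ≡.cong suc (swapAt-self c)

  swapAt-suc : ∀ c → swapAt c (suc c) ≡ c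
  swapAt-suc zero    = ≡.refl
  swapAt-suc (suc c) = ≡.cong suc (swapAt-suc c)

  swapAt-fix : ∀ c {k} → k ≢ c → k ≢ suc c → swapAt c k ≡ k
  swapAt-fix zero    {zero}          k≢c _    = ⊥-elim (k≢c ≡.refl)
  swapAt-fix zero    {suc zero}      _   k≢1+c = ⊥-elim (k≢1+c ≡.refl)
  swapAt-fix zero    {suc (suc k)}   _   _    = ≡.refl
  swapAt-fix (suc c) {zero}          _   _    = ≡.refl
  swapAt-fix (suc c) {suc k}         k≢c k≢1+c =
    ≡.cong suc (swapAt-fix c (k≢c ∘ ≡.cong suc) (k≢1+c ∘ ≡.cong suc))

  swapAt-punchIn-self : ∀ c b → swapAt c (punchIn c b) ≡ punchIn (suc c) b
  swapAt-punchIn-self zero    zero    = ≡.refl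
  swapAt-punchIn-self zero    (suc b) = ≡.refl
  swapAt-punchIn-self (suc c) zero    = ≡.refl
  swapAt-punchIn-self (suc c) (suc b) = ≡.cong suc (swapAt-punchIn-self c b)

  swapAt-punchIn-suc : ∀ c b → swapAt c (punchIn (suc c) b) ≡ punchIn c b
  swapAt-punchIn-suc zero    zero    = ≡.refl
  swapAt-punchIn-suc zero    (suc b) = ≡.refl
  swapAt-punchIn-suc (suc c) zero    = ≡.refl
  swapAt-punchIn-suc (suc c) (suc b) = ≡.cong suc (swapAt-punchIn-suc c b)

  swapAt-punchIn-below : ∀ {k c} b → k ≤ c → swapAt (suc c) (punchIn k b) ≡ punchIn k (swapAt c b)
  swapAt-punchIn-below {zero}                b       _         = ≡.refl
  swapAt-punchIn-below {suc k} {suc c} zero    _         = ≡.refl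
  swapAt-punchIn-below {suc k} {suc c} (suc b) (s≤s k≤c) = ≡.cong suc (swapAt-punchIn-below b k≤c)

  swapAt-punchIn-above : ∀ {k c} b → suc (suc c) ≤ k → swapAt c (punchIn k b) ≡ punchIn k (swapAt c b)
  swapAt-punchIn-above {suc zero}    {zero}  _             (s≤s ())
  swapAt-punchIn-above {suc (suc k)} {zero}  zero          _         = ≡.refl
  swapAt-punchIn-above {suc (suc k)} {zero}  (suc zero)    _         = ≡.refl
  swapAt-punchIn-above {suc (suc k)} {zero}  (suc (suc b)) _         = ≡.refl
  swapAt-punchIn-above {suc k}       {suc c} zero          _         = ≡.refl
  swapAt-punchIn-above {suc k}       {suc c} (suc b)       (s≤s 2+c≤k) = ≡.cong suc (swapAt-punchIn-above b 2+c≤k)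

  data Apart (c k : ℕ) : Set where
    below : ∀ c′ → c ≡ suc c′ → k ≤ c′ → Apart c k
    above : suc (suc c) ≤ k → Apart c k

  apart : ∀ c k → k ≢ c → k ≢ suc c → Apart c k
  apart c k k≢c k≢1+c with ℕₚ.<-cmp k c
  apart (suc c′) k _ _ | tri< (s≤s k≤c′) _ _ = below c′ ≡.refl k≤c′
  ... | tri≈ _ k≡c _ = ⊥-elim (k≢c k≡c)
  ... | tri> _ _ c<k with ℕₚ.<-cmp k (suc c)
  ...   | tri< k<1+c _ _ = ⊥-elim (ℕₚ.<⇒≱ c<k (ℕₚ.≤-pred k<1+c))
  ...   | tri≈ _ k≡1+c _ = ⊥-elim (k≢1+c k≡1+c)
  ...   | tri> _ _ 1+c<k = above 1+c<k

  sum-swapAt : ∀ n c f → suc c < n → sumUpTo n (f ∘ swapAt c) ≈ sumUpTo n f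
  sum-swapAt (suc n) c f (s≤s 1+c≤n) with suc c ≟ n
  ... | yes ≡.refl = begin
    (sumUpTo c (f ∘ swapAt c) ⊕ f (swapAt c c)) ⊕ f (swapAt c (suc c))
      ≈⟨ +-cong (+-cong (sum-cong< c λ k k<c → reflexive (≡.cong f (swapAt-fix c (ℕₚ.<⇒≢ k<c) (ℕₚ.<⇒≢ (ℕₚ.m<n⇒m<1+n k<c)))))
                        (reflexive (≡.cong f (swapAt-self c))))
                (reflexive (≡.cong f (swapAt-suc c))) ⟩
    (sumUpTo c f ⊕ f (suc c)) ⊕ f c   ≈⟨ +-assoc _ _ _ ⟩
    sumUpTo c f ⊕ (f (suc c) ⊕ f c)   ≈⟨ +-congˡ (+-comm _ _) ⟩
    sumUpTo c f ⊕ (f c ⊕ f (suc c))   ≈⟨ +-assoc _ _ _ ⟨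
    (sumUpTo c f ⊕ f c) ⊕ f (suc c)   ∎
  ... | no 1+c≢n = +-cong (sum-swapAt n c f 1+c<n) (reflexive (≡.cong f (swapAt-fix c n≢c (1+c≢n ∘ ≡.sym))))
    where
    1+c<n : suc c < n
    1+c<n = ℕₚ.≤∧≢⇒< 1+c≤n 1+c≢n
    n≢c : n ≢ c
    n≢c ≡.refl = ℕₚ.<-irrefl ≡.refl (ℕₚ.<-trans (ℕₚ.n<1+n n) 1+c<n)

  sum-pair : ∀ n f c → suc c < n → (∀ j → j < n → j ≢ c → j ≢ suc c → f j ≈ 0#) →
             sumUpTo n f ≈ f c ⊕ f (suc c)
  sum-pair (suc n) f c (s≤s 1+c≤n) f≈0 with suc c ≟ n
  ... | yes ≡.refl = +-congʳ (sum-single (suc c) f c ℕₚ.≤-refl λ j j<1+c j≢c →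
                       f≈0 j (ℕₚ.m<n⇒m<1+n j<1+c) j≢c (ℕₚ.<⇒≢ j<1+c))
  ... | no 1+c≢n = trans (+-cong (sum-pair n f c 1+c<n λ j j<n → f≈0 j (ℕₚ.m<n⇒m<1+n j<n))
                                 (f≈0 n ℕₚ.≤-refl n≢c (1+c≢n ∘ ≡.sym)))
                         (+-identityʳ _)
    where
    1+c<n : suc c < n
    1+c<n = ℕₚ.≤∧≢⇒< 1+c≤n 1+c≢n
    n≢c : n ≢ c
    n≢c ≡.refl = ℕₚ.<-irrefl ≡.refl (ℕₚ.<-trans (ℕₚ.n<1+n n) 1+c<n)

  sign-suc-· : ∀ k x → sign (suc k) · x ≈ - (sign k · x)
  sign-suc-· k x = trans (*-congʳ (sign-suc k)) (sym (-‿distribˡ-* _ _))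

  swapColumns : ℕ → Matrix → Matrix
  swapColumns c M i j = M i (swapAt c j)

  detℕ-swapColumns : ∀ n c M → suc c < n → detℕ n (swapColumns c M) ≈ - detℕ n M
  detℕ-swapColumns (suc n) c M (s≤s 1+c≤n) = begin
    detℕ (suc n) (swapColumns c M)              ≈⟨ sum-cong< (suc n) termwise ⟩
    sumUpTo (suc n) (λ k → - T (swapAt c k))    ≈⟨ -‿distrib-sum (suc n) _ ⟩
    - sumUpTo (suc n) (T ∘ swapAt c)            ≈⟨ -‿cong (sum-swapAt (suc n) c T (s≤s 1+c≤n)) ⟩
    - detℕ (suc n) M                            ∎
    where
    T : ℕ → Carrier
    T k = sign k · (M 0 k · detℕ n (minor k M))
    termwise : ∀ k → k < suc n →
               sign k · (M 0 (swapAt c k) · detℕ n (minor k (swapColumns c M))) ≈ - T (swapAt c k)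
    termwise k k<1+n with k ≟ c | k ≟ suc c
    ... | yes ≡.refl | _ = begin
      sign k · (M 0 (swapAt k k) · detℕ n (minor k (swapColumns k M)))
        ≈⟨ *-congˡ (*-cong (reflexive (≡.cong (M 0) (swapAt-self k)))
                           (detℕ-cong n λ a b → reflexive (≡.cong (M (suc a)) (swapAt-punchIn-self k b)))) ⟩
      sign k · (M 0 (suc k) · detℕ n (minor (suc k) M))
        ≈⟨ ⁻¹-involutive _ ⟨
      - - (sign k · (M 0 (suc k) · detℕ n (minor (suc k) M)))
        ≈⟨ -‿cong (sign-suc-· k _) ⟨
      - T (suc k)
        ≡⟨ ≡.cong (-_ ∘ T) (swapAt-self k) ⟨
      - T (swapAt k k) ∎
    ... | no _ | yes ≡.refl = begin
      sign (suc c) · (M 0 (swapAt c (suc c)) · detℕ n (minor (suc c) (swapColumns c M)))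
        ≈⟨ *-congˡ (*-cong (reflexive (≡.cong (M 0) (swapAt-suc c)))
                           (detℕ-cong n λ a b → reflexive (≡.cong (M (suc a)) (swapAt-punchIn-suc c b)))) ⟩
      sign (suc c) · (M 0 c · detℕ n (minor c M))
        ≈⟨ sign-suc-· c _ ⟩
      - T c
        ≡⟨ ≡.cong (-_ ∘ T) (swapAt-suc c) ⟨
      - T (swapAt c (suc c)) ∎
    ... | no k≢c | no k≢1+c = begin
      sign k · (M 0 (swapAt c k) · detℕ n (minor k (swapColumns c M)))
        ≈⟨ *-congˡ (*-cong (reflexive (≡.cong (M 0) fixed)) (minor-swapped (apart c k k≢c k≢1+c))) ⟩
      sign k · (M 0 k · - detℕ n (minor k M))
        ≈⟨ trans (*-congˡ (sym (-‿distribʳ-* _ _))) (sym (-‿distribʳ-* _ _)) ⟩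
      - T k
        ≡⟨ ≡.cong (-_ ∘ T) fixed ⟨
      - T (swapAt c k) ∎
      where
      fixed : swapAt c k ≡ k
      fixed = swapAt-fix c k≢c k≢1+c
      minor-swapped : Apart c k → detℕ n (minor k (swapColumns c M)) ≈ - detℕ n (minor k M)
      minor-swapped (below c′ ≡.refl k≤c′) =
        trans (detℕ-cong n λ a b → reflexive (≡.cong (M (suc a)) (swapAt-punchIn-below b k≤c′)))
              (detℕ-swapColumns n c′ (minor k M) 1+c≤n)
      minor-swapped (above 2+c≤k) =
        trans (detℕ-cong n λ a b → reflexive (≡.cong (M (suc a)) (swapAt-punchIn-above b 2+c≤k)))
              (detℕ-swapColumns n c (minor k M) (ℕₚ.≤-trans 2+c≤k (ℕₚ.≤-pred k<1+n)))

  minor-adjacent-equal : ∀ {c} M → (∀ i → M i c ≈ M i (suc c)) → ∀ a b → minor c M a b ≈ minor (suc c) M a b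
  minor-adjacent-equal {c} M col≈ a b with ℕₚ.<-cmp b c
  ... | tri< b<c _ _ = reflexive (≡.cong (M (suc a)) (≡.trans (punchIn-< b<c) (≡.sym (punchIn-< (ℕₚ.m<n⇒m<1+n b<c)))))
  ... | tri≈ _ ≡.refl _ = trans (reflexive (≡.cong (M (suc a)) (punchIn-≥ ℕₚ.≤-refl)))
                                (trans (sym (col≈ (suc a))) (reflexive (≡.cong (M (suc a)) (≡.sym (punchIn-< ℕₚ.≤-refl)))))
  ... | tri> _ _ c<b = reflexive (≡.cong (M (suc a)) (≡.trans (punchIn-≥ (ℕₚ.<⇒≤ c<b)) (≡.sym (punchIn-≥ c<b))))

  detℕ-adjacent-equal-columns : ∀ n c M → suc c < n → (∀ i → M i c ≈ M i (suc c)) → detℕ n M ≈ 0#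
  detℕ-adjacent-equal-columns (suc n) c M (s≤s 1+c≤n) col≈ =
    trans (sum-pair (suc n) T c (s≤s 1+c≤n) others) pair
    where
    T : ℕ → Carrier
    T k = sign k · (M 0 k · detℕ n (minor k M))
    minor≈0 : ∀ {k} → k < suc n → Apart c k → detℕ n (minor k M) ≈ 0#
    minor≈0 {k} _ (below c′ ≡.refl k≤c′) = detℕ-adjacent-equal-columns n c′ (minor k M) 1+c≤n λ i → begin
      M (suc i) (punchIn k c′)             ≡⟨ ≡.cong (M (suc i)) (punchIn-≥ k≤c′) ⟩
      M (suc i) (suc c′)                   ≈⟨ col≈ (suc i) ⟩
      M (suc i) (suc (suc c′))             ≡⟨ ≡.cong (M (suc i)) (punchIn-≥ (ℕₚ.m≤n⇒m≤1+n k≤c′)) ⟨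
      M (suc i) (punchIn k (suc c′))       ∎
    minor≈0 {suc k} 1+k<1+n (above (s≤s 1+c≤k)) =
      detℕ-adjacent-equal-columns n c (minor (suc k) M) (ℕₚ.≤-trans (s≤s 1+c≤k) (ℕₚ.≤-pred 1+k<1+n)) λ i → begin
      M (suc i) (punchIn (suc k) c)        ≡⟨ ≡.cong (M (suc i)) (punchIn-< (ℕₚ.m<n⇒m<1+n 1+c≤k)) ⟩
      M (suc i) c                          ≈⟨ col≈ (suc i) ⟩
      M (suc i) (suc c)                    ≡⟨ ≡.cong (M (suc i)) (punchIn-< (s≤s 1+c≤k)) ⟨
      M (suc i) (punchIn (suc k) (suc c))  ∎
    others : ∀ k → k < suc n → k ≢ c → k ≢ suc c → T k ≈ 0#
    others k k<1+n k≢c k≢1+c =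
      trans (*-congˡ (*-congˡ (minor≈0 k<1+n (apart c k k≢c k≢1+c)))) (trans (*-congˡ (zeroʳ _)) (zeroʳ _))
    pair : T c ⊕ T (suc c) ≈ 0#
    pair = begin
      T c ⊕ T (suc c)
        ≈⟨ +-congˡ (sign-suc-· c _) ⟩
      T c ⊕ - (sign c · (M 0 (suc c) · detℕ n (minor (suc c) M)))
        ≈⟨ +-congˡ (-‿cong (*-congˡ (*-cong (sym (col≈ 0)) (detℕ-cong n (λ a b → sym (minor-adjacent-equal M col≈ a b)))))) ⟩
      T c ⊖ T c
        ≈⟨ -‿inverseʳ _ ⟩
      0# ∎

  detℕ-equal-columns : ∀ n M {q r} → q < r → r < n → (∀ i → M i q ≈ M i r) → detℕ n M ≈ 0#
  detℕ-equal-columns n M {q} {r} q<r r<n col≈ =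
    go (r ∸ suc q) M (≡.subst (_< n) (≡.sym q+[r-q]≡r) r<n) (λ i → trans (col≈ i) (reflexive (≡.cong (M i) (≡.sym q+[r-q]≡r))))
    where
    q+[r-q]≡r : q + suc (r ∸ suc q) ≡ r
    q+[r-q]≡r = ≡.trans (ℕₚ.+-suc q _) (ℕₚ.m+[n∸m]≡n q<r)
    go : ∀ d M → q + suc d < n → (∀ i → M i q ≈ M i (q + suc d)) → detℕ n M ≈ 0#
    go zero M q+1<n col≈ rewrite ℕₚ.+-comm q 1 = detℕ-adjacent-equal-columns n q M q+1<n col≈
    go (suc d) M q+2+d<n col≈ = begin
      detℕ n M                         ≈⟨ ⁻¹-involutive _ ⟨
      - - detℕ n M                     ≈⟨ -‿cong (detℕ-swapColumns n p M 1+p<n) ⟨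
      - detℕ n (swapColumns p M)       ≈⟨ -‿cong (go d (swapColumns p M) (ℕₚ.<-trans (ℕₚ.n<1+n p) 1+p<n) col≈′) ⟩
      - 0#                             ≈⟨ ε⁻¹≈ε ⟩
      0#                               ∎
      where
      p = q + suc d
      1+p≡q+2+d : suc p ≡ q + suc (suc d)
      1+p≡q+2+d = ≡.sym (ℕₚ.+-suc q (suc d))
      1+p<n : suc p < n
      1+p<n = ≡.subst (_< n) (≡.sym 1+p≡q+2+d) q+2+d<n
      q<p : q < p
      q<p = ℕₚ.m<m+n q (s≤s z≤n)
      col≈′ : ∀ i → swapColumns p M i q ≈ swapColumns p M i p
      col≈′ i = begin
        M i (swapAt p q)          ≡⟨ ≡.cong (M i) (swapAt-fix p (ℕₚ.<⇒≢ q<p) (ℕₚ.<⇒≢ (ℕₚ.m<n⇒m<1+n q<p))) ⟩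
        M i q                     ≈⟨ col≈ i ⟩
        M i (q + suc (suc d))     ≡⟨ ≡.cong (M i) (≡.trans (swapAt-self p) 1+p≡q+2+d) ⟨
        M i (swapAt p p)          ∎

  detℕ-equal-rows : ∀ n M {q r} → q < r → r < n → (∀ j → M q j ≈ M r j) → detℕ n M ≈ 0#
  detℕ-equal-rows n M q<r r<n row≈ = trans (sym (detℕ-ᵀ n M)) (detℕ-equal-columns n (M ᵀ) q<r r<n row≈)

  -- lowerMul P M is P·M for P lower triangular: the entries of P above the diagonal are never read.
  lowerMul : Matrix → Matrix → Matrix
  lowerMul P M i t = sumUpTo (suc i) (λ a → P i a · M a t)

  spliceRows : ℕ → Matrix → Matrix → Matrix
  spliceRows k M N i with i <? k
  ... | yes _ = M i
  ... | no  _ = N i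

  spliceRows-< : ∀ {k i} M N j → i < k → spliceRows k M N i j ≡ M i j
  spliceRows-< {k} {i} M N j i<k with i <? k
  ... | yes _   = ≡.refl
  ... | no  i≮k = ⊥-elim (i≮k i<k)

  spliceRows-≥ : ∀ {k i} M N j → k ≤ i → spliceRows k M N i j ≡ N i j
  spliceRows-≥ {k} {i} M N j k≤i with i <? k
  ... | yes i<k = ⊥-elim (ℕₚ.<⇒≱ i<k k≤i)
  ... | no  _   = ≡.refl

  detℕ-lowerMul-step : ∀ n P M k → k < n →
    detℕ n (spliceRows k M (lowerMul P M)) ≈ P k k · detℕ n (spliceRows (suc k) M (lowerMul P M))
  detℕ-lowerMul-step n P M k k<n = begin
    detℕ n (spliceRows k M (lowerMul P M))
      ≈⟨ detℕ-cong n as-replaceRow ⟩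
    detℕ n (replaceRow k (lowerMul P M k) N)
      ≈⟨ detℕ-row-sum n k k<n N (suc k) (P k) M ⟩
    sumUpTo k (λ a → P k a · detℕ n (replaceRow k (M a) N)) ⊕ P k k · detℕ n (replaceRow k (M k) N)
      ≈⟨ +-cong (sum-zero k λ a a<k → trans (*-congˡ (detℕ-equal-rows n _ a<k k<n (repeated a a<k))) (zeroʳ _))
                (*-congˡ (detℕ-cong n unchanged)) ⟩
    0# ⊕ P k k · detℕ n N
      ≈⟨ +-identityˡ _ ⟩
    P k k · detℕ n N ∎
    where
    PM = lowerMul P M
    N = spliceRows (suc k) M PM
    as-replaceRow : ∀ i j → spliceRows k M (lowerMul P M) i j ≈ replaceRow k (lowerMul P M k) N i j
    as-replaceRow i j with ℕₚ.<-cmp i k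
    ... | tri< i<k _ _ = reflexive (≡.trans (spliceRows-< M PM j i<k)
                           (≡.sym (≡.trans (replaceRow-≢ _ N j (ℕₚ.<⇒≢ i<k)) (spliceRows-< M PM j (ℕₚ.m<n⇒m<1+n i<k)))))
    ... | tri≈ _ ≡.refl _ = reflexive (≡.trans (spliceRows-≥ M PM j ℕₚ.≤-refl) (≡.sym (replaceRow-≡ i _ N j)))
    ... | tri> _ _ k<i = reflexive (≡.trans (spliceRows-≥ M PM j (ℕₚ.<⇒≤ k<i))
                           (≡.sym (≡.trans (replaceRow-≢ _ N j (ℕₚ.>⇒≢ k<i)) (spliceRows-≥ M PM j k<i))))
    repeated : ∀ a → a < k → ∀ j → replaceRow k (M a) N a j ≈ replaceRow k (M a) N k j
    repeated a a<k j = reflexive (≡.trans (replaceRow-≢ _ N j (ℕₚ.<⇒≢ a<k))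
                         (≡.trans (spliceRows-< M PM j (ℕₚ.m<n⇒m<1+n a<k)) (≡.sym (replaceRow-≡ k _ N j))))
    unchanged : ∀ i j → replaceRow k (M k) N i j ≈ N i j
    unchanged i j with ℕₚ.<-cmp i k
    ... | tri< i<k _ _    = reflexive (replaceRow-≢ _ N j (ℕₚ.<⇒≢ i<k))
    ... | tri≈ _ ≡.refl _ = reflexive (≡.trans (replaceRow-≡ i _ N j) (≡.sym (spliceRows-< M PM j ℕₚ.≤-refl)))
    ... | tri> _ _ k<i    = reflexive (replaceRow-≢ _ N j (ℕₚ.>⇒≢ k<i))

  detℕ-lowerMul : ∀ n P M → detℕ n (lowerMul P M) ≈ prodUpTo n (λ i → P i i) · detℕ n M
  detℕ-lowerMul n P M = begin
    detℕ n (lowerMul P M)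
      ≈⟨ detℕ-cong n (λ i j → reflexive (≡.sym (spliceRows-≥ M (lowerMul P M) j z≤n))) ⟩
    detℕ n (spliceRows 0 M (lowerMul P M))                 ≈⟨ *-identityˡ _ ⟨
    1# · detℕ n (spliceRows 0 M (lowerMul P M))            ≈⟨ from 0 n ≡.refl ⟩
    prodUpTo n (λ i → P i i) · detℕ n M                    ∎
    where
    from : ∀ k d → k + d ≡ n →
           prodUpTo k (λ i → P i i) · detℕ n (spliceRows k M (lowerMul P M)) ≈ prodUpTo n (λ i → P i i) · detℕ n M
    from k zero k+0≡n rewrite ℕₚ.+-identityʳ k | k+0≡n =
      *-congˡ (detℕ-cong< n λ i j i<n _ → reflexive (spliceRows-< M (lowerMul P M) j i<n))
    from k (suc d) k+1+d≡n = begin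
      prodUpTo k (λ i → P i i) · detℕ n (spliceRows k M (lowerMul P M))
        ≈⟨ *-congˡ (detℕ-lowerMul-step n P M k k<n) ⟩
      prodUpTo k (λ i → P i i) · (P k k · detℕ n (spliceRows (suc k) M (lowerMul P M)))
        ≈⟨ *-assoc _ _ _ ⟨
      prodUpTo (suc k) (λ i → P i i) · detℕ n (spliceRows (suc k) M (lowerMul P M))
        ≈⟨ from (suc k) d (≡.trans (≡.sym (ℕₚ.+-suc k d)) k+1+d≡n) ⟩
      prodUpTo n (λ i → P i i) · detℕ n M ∎
      where
      k<n : k < n
      k<n = ≡.subst (k <_) k+1+d≡n (ℕₚ.m<m+n k (s≤s z≤n))

  reversalSign : ℕ → Carrier
  reversalSign m = prodUpTo m sign

  detℕ-antitriangular-block : ∀ m n M c →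
    (∀ i j → i < m → i + j < m ∸ 1 → M i j ≈ 0#) →
    (∀ i j → i < m → m ≤ j → j < m + n → M i j ≈ 0#) →
    (∀ i → i < m → M i (m ∸ 1 ∸ i) ≈ c) →
    detℕ (m + n) M ≈ reversalSign m · (pow c m · detℕ n (λ a b → M (m + a) (m + b)))
  detℕ-antitriangular-block zero    n M c _ _ _ = sym (trans (*-identityˡ _) (*-identityˡ _))
  detℕ-antitriangular-block (suc m) n M c above-antidiagonal≈0 right≈0 antidiagonal≈c = begin
    detℕ (suc (m + n)) M
      ≈⟨ sum-single (suc (m + n)) _ m (s≤s (ℕₚ.m≤m+n m n)) others≈0 ⟩
    sign m · (M 0 m · detℕ (m + n) (minor m M))
      ≈⟨ *-congˡ (*-cong (antidiagonal≈c 0 (s≤s z≤n))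
                         (detℕ-antitriangular-block m n (minor m M) c above-antidiagonal≈0′ right≈0′ antidiagonal≈c′)) ⟩
    sign m · (c · (reversalSign m · (pow c m · detℕ n (λ a b → M (suc (m + a)) (punchIn m (m + b))))))
      ≈⟨ *-congˡ (*-congˡ (*-congˡ (*-congˡ (detℕ-cong n λ a b → reflexive (≡.cong (M (suc (m + a))) (punchIn-≥ (ℕₚ.m≤m+n m b))))))) ⟩
    sign m · (c · (reversalSign m · (pow c m · D)))
      ≈⟨ solve 5 (λ s c r p D → s :* (c :* (r :* (p :* D))) := (r :* s) :* ((p :* c) :* D)) refl (sign m) c (reversalSign m) (pow c m) D ⟩
    reversalSign (suc m) · (pow c (suc m) · D) ∎
    where
    D = detℕ n (λ a b → M (suc m + a) (suc m + b))
    first-row≈0 : ∀ j → j < suc (m + n) → j ≢ m → M 0 j ≈ 0#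
    first-row≈0 j j<1+m+n j≢m with ℕₚ.<-cmp j m
    ... | tri< j<m _ _ = above-antidiagonal≈0 0 j (s≤s z≤n) j<m
    ... | tri≈ _ j≡m _ = ⊥-elim (j≢m j≡m)
    ... | tri> _ _ m<j = right≈0 0 j (s≤s z≤n) m<j j<1+m+n
    others≈0 : ∀ j → j < suc (m + n) → j ≢ m → sign j · (M 0 j · detℕ (m + n) (minor j M)) ≈ 0#
    others≈0 j j<1+m+n j≢m = trans (*-congˡ (trans (*-congʳ (first-row≈0 j j<1+m+n j≢m)) (zeroˡ _))) (zeroʳ _)
    above-antidiagonal≈0′ : ∀ i j → i < m → i + j < m ∸ 1 → minor m M i j ≈ 0#
    above-antidiagonal≈0′ i j i<m i+j<m-1 =
      trans (reflexive (≡.cong (M (suc i)) (punchIn-< j<m)))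
            (above-antidiagonal≈0 (suc i) j (s≤s i<m) (<∸1⇒suc< i+j<m-1))
      where
      j<m : j < m
      j<m = ℕₚ.<-≤-trans (ℕₚ.≤-<-trans (ℕₚ.m≤n+m j i) i+j<m-1) (ℕₚ.m∸n≤m m 1)
    right≈0′ : ∀ i j → i < m → m ≤ j → j < m + n → minor m M i j ≈ 0#
    right≈0′ i j i<m m≤j j<m+n =
      trans (reflexive (≡.cong (M (suc i)) (punchIn-≥ m≤j))) (right≈0 (suc i) (suc j) (s≤s i<m) (s≤s m≤j) (s≤s j<m+n))
    antidiagonal≈c′ : ∀ i → i < m → minor m M i (m ∸ 1 ∸ i) ≈ c
    antidiagonal≈c′ i i<m =
      trans (reflexive (≡.cong (M (suc i)) (≡.trans (punchIn-< (ℕₚ.≤-<-trans (ℕₚ.m∸n≤m (m ∸ 1) i) (m∸1<m (ℕₚ.≤-<-trans z≤n i<m))))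
                                                    (ℕₚ.∸-+-assoc m 1 i))))
            (antidiagonal≈c (suc i) (s≤s i<m))

  reversalSign≈pow : ∀ m → reversalSign m ≈ pow (- 1#) ((m * (m ∸ 1)) / 2)
  reversalSign≈pow zero    = refl
  reversalSign≈pow (suc m) = begin
    reversalSign m · sign m                                  ≈⟨ *-congʳ (reversalSign≈pow m) ⟩
    pow (- 1#) ((m * (m ∸ 1)) / 2) · pow (- 1#) m            ≈⟨ pow-+ (- 1#) ((m * (m ∸ 1)) / 2) m ⟨
    pow (- 1#) ((m * (m ∸ 1)) / 2 + m)                       ≡⟨ ≡.cong (pow (- 1#)) (triangular-suc m) ⟨
    pow (- 1#) ((suc m * m) / 2)                             ∎

  -- Hankel determinants

  hankel-vanish : ∀ h {m t} → (∀ k → k < m ∸ 1 → h k ≈ 0#) → 0 < t → t < m → detℕ t (Hankel h) ≈ 0#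
  hankel-vanish h {m} {suc t} h≈0 _ 1+t<m = sum-zero (suc t) λ j j<1+t →
    trans (*-congˡ (trans (*-congʳ (h≈0 j (ℕₚ.<-≤-trans j<1+t (suc<⇒<∸1 1+t<m)))) (zeroˡ _))) (zeroʳ _)

  hankel-leading : ∀ h {m} → 0 < m → (∀ k → k < m ∸ 1 → h k ≈ 0#) →
                   detℕ m (Hankel h) ≈ reversalSign m · pow (h (m ∸ 1)) m
  hankel-leading h {suc m} _ h≈0 = begin
    detℕ (suc m) (Hankel h)
      ≡⟨ ≡.cong (λ k → detℕ k (Hankel h)) (ℕₚ.+-identityʳ (suc m)) ⟨
    detℕ (suc m + 0) (Hankel h)
      ≈⟨ detℕ-antitriangular-block (suc m) 0 (Hankel h) (h m)
           (λ i j _ i+j<m → h≈0 (i + j) i+j<m)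
           (λ i j _ 1+m≤j j<1+m+0 → ⊥-elim (ℕₚ.<⇒≱ j<1+m+0 (ℕₚ.≤-trans (ℕₚ.≤-reflexive (ℕₚ.+-identityʳ (suc m))) 1+m≤j)))
           (λ i i<1+m → reflexive (≡.cong h (ℕₚ.m+[n∸m]≡n (ℕₚ.≤-pred i<1+m)))) ⟩
    reversalSign (suc m) · (pow (h m) (suc m) · 1#)
      ≈⟨ *-congˡ (*-identityʳ _) ⟩
    reversalSign (suc m) · pow (h m) (suc m) ∎

  kronecker : ℕ → ℕ → Carrier
  kronecker i a with a ≟ i
  ... | yes _ = 1#
  ... | no  _ = 0#

  kronecker-diagonal : ∀ i → kronecker i i ≈ 1#
  kronecker-diagonal i with i ≟ i
  ... | yes _  = refl
  ... | no i≢i = ⊥-elim (i≢i ≡.refl)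

  sum-kronecker : ∀ i (f : ℕ → Carrier) → sumUpTo (suc i) (λ a → kronecker i a · f a) ≈ f i
  sum-kronecker i f = begin
    sumUpTo (suc i) (λ a → kronecker i a · f a)   ≈⟨ sum-single (suc i) (λ a → kronecker i a · f a) i ℕₚ.≤-refl off-diagonal ⟩
    kronecker i i · f i                           ≈⟨ *-congʳ (kronecker-diagonal i) ⟩
    1# · f i                                      ≈⟨ *-identityˡ _ ⟩
    f i                                           ∎
    where
    off-diagonal : ∀ a → a < suc i → a ≢ i → kronecker i a · f a ≈ 0#
    off-diagonal a _ a≢i with a ≟ i
    ... | yes a≡i = ⊥-elim (a≢i a≡i)
    ... | no  _   = zeroˡ _

  -- Rows below m of P are those of the identity and row m + j is [−g_{j−1}, …, −g_0, B_0, …, B_m].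
  -- By the recurrence, P·Hankel h is block triangular, with anti-triangular upper-left block
  -- (anti-diagonal h_{m−1}) and lower-right block U·Hankel g, U lower triangular with diagonal h_{m−1}.
  module HankelReduction (h g B : Series) {m : ℕ} (0<m : 0 < m)
    (h≈0 : ∀ k → k < m ∸ 1 → h k ≈ 0#)
    (recurrence : ∀ l → sumUpTo (suc m) (λ a → B a · h (a + l)) ≈ sumUpTo l (λ u → g u · h (l ∸ 1 ∸ u)))
    where

    bottomRow : ℕ → ℕ → Carrier
    bottomRow zero    a       = B a
    bottomRow (suc j) zero    = - g j
    bottomRow (suc j) (suc a) = bottomRow j a

    bottomRow-diagonal : ∀ j → bottomRow j (m + j) ≡ B m
    bottomRow-diagonal zero    = ≡.cong B (ℕₚ.+-identityʳ m)
    bottomRow-diagonal (suc j) = ≡.trans (≡.cong (bottomRow (suc j)) (ℕₚ.+-suc m j)) (bottomRow-diagonal j)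

    bottomEntry : ℕ → ℕ → Carrier
    bottomEntry j t = sumUpTo t (λ u → g (j + u) · h (t ∸ 1 ∸ u))

    bottomRow-Hankel : ∀ j t → sumUpTo (suc (m + j)) (λ a → bottomRow j a · h (a + t)) ≈ bottomEntry j t
    bottomRow-Hankel zero    t rewrite ℕₚ.+-identityʳ m = recurrence t
    bottomRow-Hankel (suc j) t rewrite ℕₚ.+-suc m j = begin
      sumUpTo (suc (suc (m + j))) (λ a → bottomRow (suc j) a · h (a + t))
        ≈⟨ sum-head (suc (m + j)) _ ⟩
      - g j · h t ⊕ sumUpTo (suc (m + j)) (λ a → bottomRow j a · h (suc a + t))
        ≈⟨ +-congˡ (sum-cong (suc (m + j)) λ a → *-congˡ (reflexive (≡.cong h (≡.sym (ℕₚ.+-suc a t))))) ⟩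
      - g j · h t ⊕ sumUpTo (suc (m + j)) (λ a → bottomRow j a · h (a + suc t))
        ≈⟨ +-congˡ (bottomRow-Hankel j (suc t)) ⟩
      - g j · h t ⊕ sumUpTo (suc t) (λ u → g (j + u) · h (t ∸ u))
        ≈⟨ +-congˡ (sum-head t _) ⟩
      - g j · h t ⊕ (g (j + 0) · h t ⊕ sumUpTo t (λ u → g (j + suc u) · h (t ∸ suc u)))
        ≈⟨ +-congˡ (+-congʳ (*-congʳ (reflexive (≡.cong g (ℕₚ.+-identityʳ j))))) ⟩
      - g j · h t ⊕ (g j · h t ⊕ sumUpTo t (λ u → g (j + suc u) · h (t ∸ suc u)))
        ≈⟨ +-assoc _ _ _ ⟨
      (- g j · h t ⊕ g j · h t) ⊕ sumUpTo t (λ u → g (j + suc u) · h (t ∸ suc u))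
        ≈⟨ +-congʳ (trans (+-congʳ (sym (-‿distribˡ-* _ _))) (-‿inverseˡ _)) ⟩
      0# ⊕ sumUpTo t (λ u → g (j + suc u) · h (t ∸ suc u))
        ≈⟨ +-identityˡ _ ⟩
      sumUpTo t (λ u → g (j + suc u) · h (t ∸ suc u))
        ≈⟨ sum-cong t (λ u → *-cong (reflexive (≡.cong g (ℕₚ.+-suc j u))) (reflexive (≡.cong h (≡.sym (ℕₚ.∸-+-assoc t 1 u))))) ⟩
      bottomEntry (suc j) t ∎

    P : Matrix
    P i with i <? m
    ... | yes _ = kronecker i
    ... | no  _ = bottomRow (i ∸ m)

    P-top : ∀ {i} a → i < m → P i a ≡ kronecker i a
    P-top {i} a i<m with i <? m
    ... | yes _   = ≡.refl
    ... | no  i≮m = ⊥-elim (i≮m i<m)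

    P-bottom : ∀ j a → P (m + j) a ≡ bottomRow j a
    P-bottom j a with (m + j) <? m
    ... | yes m+j<m = ⊥-elim (ℕₚ.<⇒≱ m+j<m (ℕₚ.m≤m+n m j))
    ... | no  _     = ≡.cong (λ k → bottomRow k a) (ℕₚ.m+n∸m≡n m j)

    X : Matrix
    X = lowerMul P (Hankel h)

    X-top : ∀ {i} t → i < m → X i t ≈ h (i + t)
    X-top {i} t i<m = trans (sum-cong (suc i) λ a → *-congʳ (reflexive (P-top a i<m))) (sum-kronecker i (λ a → h (a + t)))

    X-bottom : ∀ j t → X (m + j) t ≈ bottomEntry j t
    X-bottom j t = trans (sum-cong (suc (m + j)) λ a → *-congʳ (reflexive (P-bottom j a))) (bottomRow-Hankel j t)

    U : Matrix
    U a u = h (m ∸ 1 + a ∸ u)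

    X-bottom-right : ∀ a j → X (m + j) (m + a) ≈ lowerMul U (Hankel g) a j
    X-bottom-right a j = begin
      X (m + j) (m + a)
        ≈⟨ X-bottom j (m + a) ⟩
      sumUpTo (m + a) (λ u → g (j + u) · h (m + a ∸ 1 ∸ u))
        ≈⟨ sum-extend _ (ℕₚ.+-monoˡ-≤ a 0<m) beyond-antidiagonal ⟩
      sumUpTo (suc a) (λ u → g (j + u) · h (m + a ∸ 1 ∸ u))
        ≈⟨ sum-cong (suc a) (λ u → trans (*-comm _ _) (*-cong (reflexive (≡.cong (λ k → h (k ∸ u)) (ℕₚ.+-∸-comm a 0<m)))
                                                             (reflexive (≡.cong g (ℕₚ.+-comm j u))))) ⟩
      lowerMul U (Hankel g) a j ∎
      where
      m+a-1-a≡m-1 : m + a ∸ 1 ∸ a ≡ m ∸ 1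
      m+a-1-a≡m-1 = ≡.trans (ℕₚ.∸-+-assoc (m + a) 1 a)
                      (≡.trans (≡.cong₂ _∸_ (ℕₚ.+-comm m a) (ℕₚ.+-comm 1 a)) (ℕₚ.[m+n]∸[m+o]≡n∸o a m 1))
      beyond-antidiagonal : ∀ u → suc a ≤ u → u < m + a → g (j + u) · h (m + a ∸ 1 ∸ u) ≈ 0#
      beyond-antidiagonal u a<u u<m+a = trans (*-congˡ (h≈0 _ (≡.subst (m + a ∸ 1 ∸ u <_) m+a-1-a≡m-1
        (ℕₚ.∸-monoʳ-< a<u (<⇒≤∸1 u<m+a))))) (zeroʳ _)

    P-diagonal : ∀ n → prodUpTo (m + n) (λ i → P i i) ≈ pow (B m) n
    P-diagonal n = begin
      prodUpTo (m + n) (λ i → P i i)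
        ≈⟨ prodUpTo-+ m n _ ⟩
      prodUpTo m (λ i → P i i) · prodUpTo n (λ t → P (m + t) (m + t))
        ≈⟨ *-cong (prodUpTo-const m λ i i<m → trans (reflexive (P-top i i<m)) (kronecker-diagonal i))
                  (prodUpTo-const n λ t _ → reflexive (≡.trans (P-bottom t (m + t)) (bottomRow-diagonal t))) ⟩
      pow 1# m · pow (B m) n
        ≈⟨ *-congʳ (pow-1# m) ⟩
      1# · pow (B m) n
        ≈⟨ *-identityˡ _ ⟩
      pow (B m) n ∎

    hankel-reduction : ∀ n → pow (B m) n · detℕ (m + n) (Hankel h) ≈
                             detℕ m (Hankel h) · (pow (h (m ∸ 1)) n · detℕ n (Hankel g))
    hankel-reduction n = begin
      pow (B m) n · detℕ (m + n) (Hankel h)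
        ≈⟨ *-congʳ (P-diagonal n) ⟨
      prodUpTo (m + n) (λ i → P i i) · detℕ (m + n) (Hankel h)
        ≈⟨ detℕ-lowerMul (m + n) P (Hankel h) ⟨
      detℕ (m + n) X
        ≈⟨ detℕ-ᵀ (m + n) X ⟨
      detℕ (m + n) (X ᵀ)
        ≈⟨ detℕ-antitriangular-block m n (X ᵀ) c above-antidiagonal≈0 right≈0 antidiagonal≈c ⟩
      reversalSign m · (pow c m · detℕ n (λ a j → X (m + j) (m + a)))
        ≈⟨ *-congˡ (*-congˡ (detℕ-cong n X-bottom-right)) ⟩
      reversalSign m · (pow c m · detℕ n (lowerMul U (Hankel g)))
        ≈⟨ *-congˡ (*-congˡ (detℕ-lowerMul n U (Hankel g))) ⟩
      reversalSign m · (pow c m · (prodUpTo n (λ a → U a a) · detℕ n (Hankel g)))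
        ≈⟨ *-congˡ (*-congˡ (*-congʳ (prodUpTo-const n λ a _ → reflexive (≡.cong h (ℕₚ.m+n∸n≡m (m ∸ 1) a))))) ⟩
      reversalSign m · (pow c m · (pow c n · detℕ n (Hankel g)))
        ≈⟨ *-assoc _ _ _ ⟨
      (reversalSign m · pow c m) · (pow c n · detℕ n (Hankel g))
        ≈⟨ *-congʳ (hankel-leading h 0<m h≈0) ⟨
      detℕ m (Hankel h) · (pow c n · detℕ n (Hankel g)) ∎
      where
      c = h (m ∸ 1)
      above-antidiagonal≈0 : ∀ i j → i < m → i + j < m ∸ 1 → X j i ≈ 0#
      above-antidiagonal≈0 i j _ i+j<m-1 =
        trans (X-top i (ℕₚ.<-≤-trans (ℕₚ.≤-<-trans (ℕₚ.m≤n+m j i) i+j<m-1) (ℕₚ.m∸n≤m m 1)))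
              (h≈0 (j + i) (≡.subst (_< m ∸ 1) (ℕₚ.+-comm i j) i+j<m-1))
      right≈0 : ∀ i j → i < m → m ≤ j → j < m + n → X j i ≈ 0#
      right≈0 i j i<m m≤j _ = begin
        X j i                  ≡⟨ ≡.cong (λ k → X k i) (ℕₚ.m+[n∸m]≡n m≤j) ⟨
        X (m + (j ∸ m)) i      ≈⟨ X-bottom (j ∸ m) i ⟩
        bottomEntry (j ∸ m) i     ≈⟨ sum-zero i (λ u u<i → trans (*-congˡ (h≈0 _ (ℕₚ.≤-<-trans (ℕₚ.m∸n≤m (i ∸ 1) u)
                                                                   (ℕₚ.∸-monoˡ-< i<m (ℕₚ.≤-trans (s≤s z≤n) u<i)))))
                                                              (zeroʳ _)) ⟩
        0#                     ∎
      antidiagonal≈c : ∀ i → i < m → X (m ∸ 1 ∸ i) i ≈ c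
      antidiagonal≈c i i<m =
        trans (X-top i (ℕₚ.≤-<-trans (ℕₚ.m∸n≤m (m ∸ 1) i) (m∸1<m 0<m)))
              (reflexive (≡.cong h (ℕₚ.m∸n+n≡m (<⇒≤∸1 i<m))))

  -- Formal power series and polynomial reversal

  shift-≥ : ∀ {e k} (p : Series) → e ≤ k → shift e p k ≡ p (k ∸ e)
  shift-≥ {e} {k} p e≤k with e ≤? k
  ... | yes _   = ≡.refl
  ... | no  e≰k = ⊥-elim (e≰k e≤k)

  shift-< : ∀ {e k} (p : Series) → k < e → shift e p k ≡ 0#
  shift-< {e} {k} p k<e with e ≤? k
  ... | yes e≤k = ⊥-elim (ℕₚ.<⇒≱ k<e e≤k)
  ... | no  _   = ≡.refl

  rev-≤ : ∀ {n k} (p : Series) → k ≤ n → rev p n k ≡ p (n ∸ k)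
  rev-≤ {n} {k} p k≤n with k ≤? n
  ... | yes _   = ≡.refl
  ... | no  k≰n = ⊥-elim (k≰n k≤n)

  rev-> : ∀ {n k} (p : Series) → n < k → rev p n k ≡ 0#
  rev-> {n} {k} p n<k with k ≤? n
  ... | yes k≤n = ⊥-elim (ℕₚ.<⇒≱ n<k k≤n)
  ... | no  _   = ≡.refl

  shift-cong : ∀ e {p q : Series} → (∀ k → p k ≈ q k) → ∀ k → shift e p k ≈ shift e q k
  shift-cong e p≈q k with e ≤? k
  ... | yes _ = p≈q (k ∸ e)
  ... | no  _ = refl

  rev-cong : ∀ n {p q : Series} → (∀ k → p k ≈ q k) → ∀ k → rev p n k ≈ rev q n k
  rev-cong n p≈q k with k ≤? n
  ... | yes _ = p≈q (n ∸ k)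
  ... | no  _ = refl

  rev-⊕ : ∀ (p q : Series) n k → rev (λ j → p j ⊕ q j) n k ≈ rev p n k ⊕ rev q n k
  rev-⊕ p q n k with k ≤? n
  ... | yes _ = refl
  ... | no  _ = sym (+-identityˡ 0#)

  rev-sum : ∀ L (coeff : ℕ → Carrier) (p : ℕ → Series) n k →
            rev (λ j → sumUpTo L (λ i → coeff i · p i j)) n k ≈ sumUpTo L (λ i → coeff i · rev (p i) n k)
  rev-sum L coeff p n k with k ≤? n
  ... | yes _ = refl
  ... | no  _ = sym (sum-zero L (λ _ _ → zeroʳ _))

  one : Series
  one zero    = 1#
  one (suc _) = 0#

  conv-congˡ : ∀ {X X′ : Series} Y → (∀ k → X k ≈ X′ k) → ∀ n → conv X Y n ≈ conv X′ Y n
  conv-congˡ Y X≈X′ n = sum-cong (suc n) (λ j → *-congʳ (X≈X′ j))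

  conv-congʳ : ∀ X {Y Y′ : Series} → (∀ k → Y k ≈ Y′ k) → ∀ n → conv X Y n ≈ conv X Y′ n
  conv-congʳ X Y≈Y′ n = sum-cong (suc n) (λ j → *-congˡ (Y≈Y′ (n ∸ j)))

  conv-comm : ∀ (X Y : Series) n → conv X Y n ≈ conv Y X n
  conv-comm X Y n = trans (sum-reverse (suc n) _) (sum-cong< (suc n) λ j j<1+n →
    trans (*-comm _ _) (*-congʳ (reflexive (≡.cong Y (ℕₚ.m∸[m∸n]≡n (ℕₚ.≤-pred j<1+n))))))

  conv-assoc : ∀ (X Y Z : Series) n → conv (conv X Y) Z n ≈ conv X (conv Y Z) n
  conv-assoc X Y Z n = begin
    sumUpTo (suc n) (λ j → conv X Y j · Z (n ∸ j))
      ≈⟨ sum-cong (suc n) (λ j → ·-distribʳ-sum (suc j) _ _) ⟩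
    sumUpTo (suc n) (λ j → sumUpTo (suc j) (λ i → (X i · Y (j ∸ i)) · Z (n ∸ j)))
      ≈⟨ sum-triangle (suc n) _ ⟩
    sumUpTo (suc n) (λ i → sumUpTo (suc n ∸ i) (λ t → (X i · Y (i + t ∸ i)) · Z (n ∸ (i + t))))
      ≈⟨ sum-cong< (suc n) inner ⟩
    conv X (conv Y Z) n ∎
    where
    inner : ∀ i → i < suc n → sumUpTo (suc n ∸ i) (λ t → (X i · Y (i + t ∸ i)) · Z (n ∸ (i + t))) ≈ X i · conv Y Z (n ∸ i)
    inner i i<1+n rewrite ℕₚ.+-∸-assoc 1 (ℕₚ.≤-pred i<1+n) = trans
      (sum-cong (suc (n ∸ i)) λ t → trans (*-assoc _ _ _)
        (*-congˡ (*-cong (reflexive (≡.cong Y (ℕₚ.m+n∸m≡n i t))) (reflexive (≡.cong Z (≡.sym (ℕₚ.∸-+-assoc n i t)))))))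
      (sym (·-distribˡ-sum (suc (n ∸ i)) (X i) _))

  conv-distribˡ-⊕ : ∀ (X Y Y′ : Series) n → conv X (λ k → Y k ⊕ Y′ k) n ≈ conv X Y n ⊕ conv X Y′ n
  conv-distribˡ-⊕ X Y Y′ n = trans (sum-cong (suc n) (λ j → distribˡ _ _ _)) (sum-distrib-⊕ (suc n) _ _)

  conv-one : ∀ (X : Series) n → conv X one n ≈ X n
  conv-one X n = begin
    conv X one n          ≈⟨ sum-single (suc n) _ n ℕₚ.≤-refl off-diagonal ⟩
    X n · one (n ∸ n)     ≡⟨ ≡.cong (λ k → X n · one k) (ℕₚ.n∸n≡0 n) ⟩
    X n · 1#              ≈⟨ *-identityʳ _ ⟩
    X n                   ∎
    where
    off-diagonal : ∀ j → j < suc n → j ≢ n → X j · one (n ∸ j) ≈ 0#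
    off-diagonal j j<1+n j≢n =
      trans (*-congˡ (one≈0 (ℕₚ.m>n⇒m∸n≢0 (ℕₚ.≤∧≢⇒< (ℕₚ.≤-pred j<1+n) j≢n)))) (zeroʳ _)
      where
      one≈0 : ∀ {k} → k ≢ 0 → one k ≈ 0#
      one≈0 {zero}  k≢0 = ⊥-elim (k≢0 ≡.refl)
      one≈0 {suc k} _   = refl

  shift-shift : ∀ a b (X : Series) n → shift a (shift b X) n ≈ shift (a + b) X n
  shift-shift a b X n with a ≤? n
  ... | no a≰n = reflexive (≡.sym (shift-< X (ℕₚ.<-≤-trans (ℕₚ.≰⇒> a≰n) (ℕₚ.m≤m+n a b))))
  ... | yes a≤n with b ≤? n ∸ a
  ...   | yes b≤n-a = reflexive (≡.sym (≡.trans (shift-≥ X a+b≤n) (≡.cong X (≡.sym (ℕₚ.∸-+-assoc n a b)))))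
    where
    a+b≤n : a + b ≤ n
    a+b≤n = ≡.subst (a + b ≤_) (ℕₚ.m+[n∸m]≡n a≤n) (ℕₚ.+-monoʳ-≤ a b≤n-a)
  ...   | no b≰n-a = reflexive (≡.sym (shift-< X n<a+b))
    where
    n<a+b : n < a + b
    n<a+b = ≡.subst (_< a + b) (ℕₚ.m+[n∸m]≡n a≤n) (ℕₚ.+-monoʳ-< a (ℕₚ.≰⇒> b≰n-a))

  conv-shift : ∀ (X Y : Series) e n → conv X (shift e Y) n ≈ shift e (conv X Y) n
  conv-shift X Y e n with e ≤? n
  ... | no e≰n = sum-zero (suc n) λ j _ →
    trans (*-congˡ (reflexive (shift-< Y (ℕₚ.≤-<-trans (ℕₚ.m∸n≤m n j) (ℕₚ.≰⇒> e≰n))))) (zeroʳ _)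
  ... | yes e≤n = begin
    sumUpTo (suc n) (λ j → X j · shift e Y (n ∸ j))
      ≈⟨ sum-extend _ (s≤s (ℕₚ.m∸n≤m n e)) beyond ⟩
    sumUpTo (suc (n ∸ e)) (λ j → X j · shift e Y (n ∸ j))
      ≈⟨ sum-cong< (suc (n ∸ e)) within ⟩
    conv X Y (n ∸ e) ∎
    where
    within : ∀ j → j < suc (n ∸ e) → X j · shift e Y (n ∸ j) ≈ X j · Y (n ∸ e ∸ j)
    within j j<1+n-e = *-congˡ (reflexive (≡.trans (shift-≥ Y e≤n-j) (≡.cong Y n-j-e≡n-e-j)))
      where
      e≤n-j : e ≤ n ∸ j
      e≤n-j = ℕₚ.m+n≤o⇒m≤o∸n e (≡.subst (_≤ n) (ℕₚ.+-comm j e) (ℕₚ.m≤o∸n⇒m+n≤o j e≤n (ℕₚ.≤-pred j<1+n-e)))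
      n-j-e≡n-e-j : n ∸ j ∸ e ≡ n ∸ e ∸ j
      n-j-e≡n-e-j = ≡.trans (ℕₚ.∸-+-assoc n j e) (≡.trans (≡.cong (n ∸_) (ℕₚ.+-comm j e)) (≡.sym (ℕₚ.∸-+-assoc n e j)))
    beyond : ∀ j → suc (n ∸ e) ≤ j → j < suc n → X j · shift e Y (n ∸ j) ≈ 0#
    beyond j n-e<j j<1+n = trans (*-congˡ (reflexive (shift-< Y n-j<e))) (zeroʳ _)
      where
      n-j<e : n ∸ j < e
      n-j<e = ≡.subst (n ∸ j <_) (ℕₚ.m∸[m∸n]≡n e≤n) (ℕₚ.∸-monoʳ-< n-e<j (ℕₚ.≤-pred j<1+n))

  conv-cancelʳ : ∀ {X Y U : Series} K → U 0 ≉ 0# → (∀ k → k < K → conv X U k ≈ conv Y U k) →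
                 ∀ k → k < K → X k ≈ Y k
  conv-cancelʳ {X} {Y} {U} (suc K) U0≉0 conv≈ k k<1+K with k ≟ K
  ... | no k≢K = conv-cancelʳ {X} {Y} {U} K U0≉0 (λ j j<K → conv≈ j (ℕₚ.m<n⇒m<1+n j<K)) k (ℕₚ.≤∧≢⇒< (ℕₚ.≤-pred k<1+K) k≢K)
  ... | yes ≡.refl = ·-cancelʳ U0≉0 (begin
    X k · U 0               ≡⟨ ≡.cong (λ j → X k · U j) (ℕₚ.n∸n≡0 k) ⟨
    X k · U (k ∸ k)         ≈⟨ +-cancelˡ (sumUpTo k (λ j → Y j · U (k ∸ j))) _ _ (begin
      sumUpTo k (λ j → Y j · U (k ∸ j)) ⊕ X k · U (k ∸ k)
        ≈⟨ +-congʳ (sum-cong< k λ j j<k → *-congʳ (sym (conv-cancelʳ {X} {Y} {U} k U0≉0 (λ i i<k → conv≈ i (ℕₚ.m<n⇒m<1+n i<k)) j j<k))) ⟩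
      conv X U k
        ≈⟨ conv≈ k ℕₚ.≤-refl ⟩
      conv Y U k ∎) ⟩
    Y k · U (k ∸ k)         ≡⟨ ≡.cong (λ j → Y k · U j) (ℕₚ.n∸n≡0 k) ⟩
    Y k · U 0               ∎)
    where open GroupProperties +-group using () renaming (∙-cancelˡ to +-cancelˡ)

  module Division (U R : Series) (U0≉0 : U 0 ≉ 0#) where

    next : ℕ → Series → Carrier
    next n X = (R n ⊖ sumUpTo n (λ j → X j · U (n ∸ j))) · U 0 ⁻¹

    -- prefix n agrees with the quotient below n; its values from n on are junk.
    prefix : ℕ → Series
    prefix zero    _ = 0#
    prefix (suc n) k with k <? n
    ... | yes _ = prefix n k
    ... | no  _ = next n (prefix n)

    quotient : Series
    quotient k = prefix (suc k) k

    quotient-next : ∀ n → quotient n ≡ next n (prefix n)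
    quotient-next n with n <? n
    ... | yes n<n = ⊥-elim (ℕₚ.<-irrefl ≡.refl n<n)
    ... | no  _   = ≡.refl

    prefix-stable : ∀ n k → k < n → prefix n k ≡ quotient k
    prefix-stable (suc n) k k<1+n with k <? n
    ... | yes k<n = prefix-stable n k k<n
    ... | no  k≮n with k ≟ n
    ...   | yes ≡.refl = ≡.sym (quotient-next k)
    ...   | no  k≢n    = ⊥-elim (k≮n (ℕₚ.≤∧≢⇒< (ℕₚ.≤-pred k<1+n) k≢n))

    quotient-conv : ∀ k → conv quotient U k ≈ R k
    quotient-conv k = begin
      sumUpTo k (λ j → quotient j · U (k ∸ j)) ⊕ quotient k · U (k ∸ k)
        ≈⟨ +-cong (sum-cong< k λ j j<k → *-congʳ (reflexive (≡.sym (prefix-stable k j j<k))))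
                  (*-cong (reflexive (quotient-next k)) (reflexive (≡.cong U (ℕₚ.n∸n≡0 k)))) ⟩
      Σ ⊕ ((R k ⊖ Σ) · U 0 ⁻¹) · U 0
        ≈⟨ +-congˡ (trans (*-assoc _ _ _) (trans (*-congˡ (trans (*-comm _ _) (⁻¹-inverse _ U0≉0))) (*-identityʳ _))) ⟩
      Σ ⊕ (R k ⊖ Σ)
        ≈⟨ +-congˡ (+-comm _ _) ⟩
      Σ ⊕ (- Σ ⊕ R k)
        ≈⟨ +-assoc _ _ _ ⟨
      (Σ ⊖ Σ) ⊕ R k
        ≈⟨ +-congʳ (-‿inverseʳ Σ) ⟩
      0# ⊕ R k
        ≈⟨ +-identityˡ _ ⟩
      R k ∎
      where Σ = sumUpTo k (λ j → prefix k j · U (k ∸ j))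

  divide : ∀ (U R : Series) → U 0 ≉ 0# → ∃[ X ] (∀ k → conv X U k ≈ R k)
  divide U R U0≉0 = quotient , quotient-conv
    where open Division U R U0≉0

  conv-by-shifts : ∀ L (X Y : Series) → (∀ i → L ≤ i → X i ≈ 0#) →
                   ∀ k → conv X Y k ≈ sumUpTo L (λ i → X i · shift i Y k)
  conv-by-shifts L X Y X≈0 k = begin
    sumUpTo (suc k) (λ i → X i · Y (k ∸ i))
      ≈⟨ sum-cong< (suc k) (λ i i<1+k → *-congˡ (reflexive (≡.sym (shift-≥ Y (ℕₚ.≤-pred i<1+k))))) ⟩
    sumUpTo (suc k) (λ i → X i · shift i Y k)
      ≈⟨ sum-agree (suc k) L _ (λ i L≤i _ → trans (*-congʳ (X≈0 i L≤i)) (zeroˡ _))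
                                (λ i k<i _ → trans (*-congˡ (reflexive (shift-< Y k<i))) (zeroʳ _)) ⟩
    sumUpTo L (λ i → X i · shift i Y k) ∎

  shift-vanish : ∀ i {b} (Q : Series) → (∀ j → b < j → Q j ≈ 0#) → ∀ j → i + b < j → shift i Q j ≈ 0#
  shift-vanish i {b} Q Q≈0 j i+b<j = trans (reflexive (shift-≥ Q i≤j)) (Q≈0 (j ∸ i) b<j-i)
    where
    i≤j : i ≤ j
    i≤j = ℕₚ.≤-trans (ℕₚ.m≤m+n i b) (ℕₚ.<⇒≤ i+b<j)
    b<j-i : b < j ∸ i
    b<j-i = ℕₚ.m+n≤o⇒m≤o∸n (suc b) (≡.subst (_≤ j) (≡.cong suc (ℕₚ.+-comm i b)) i+b<j)

  rev-shift : ∀ i c (Q : Series) k → rev (shift i Q) (i + c) k ≈ rev Q c k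
  rev-shift i c Q k with k ≤? c
  ... | yes k≤c = begin
    rev (shift i Q) (i + c) k     ≡⟨ rev-≤ _ (ℕₚ.≤-trans k≤c (ℕₚ.m≤n+m c i)) ⟩
    shift i Q (i + c ∸ k)         ≡⟨ ≡.cong (shift i Q) (ℕₚ.+-∸-assoc i k≤c) ⟩
    shift i Q (i + (c ∸ k))       ≡⟨ shift-≥ Q (ℕₚ.m≤m+n i (c ∸ k)) ⟩
    Q (i + (c ∸ k) ∸ i)           ≡⟨ ≡.cong Q (ℕₚ.m+n∸m≡n i (c ∸ k)) ⟩
    Q (c ∸ k)                     ∎
  ... | no k≰c with k ≤? i + c
  ...   | yes k≤i+c = reflexive (shift-< Q i+c-k<i)
    where
    i+c-k<i : i + c ∸ k < i
    i+c-k<i = ≡.subst (i + c ∸ k <_) (ℕₚ.m+n∸n≡m i c) (ℕₚ.∸-monoʳ-< (ℕₚ.≰⇒> k≰c) k≤i+c)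
  ...   | no  _     = refl

  rev-pad : ∀ e c (Q : Series) → (∀ j → c < j → Q j ≈ 0#) → ∀ k → rev Q (e + c) k ≈ shift e (rev Q c) k
  rev-pad e c Q Q≈0 k with k ≤? e + c | e ≤? k
  ... | yes k≤e+c | yes e≤k = reflexive (≡.trans (≡.cong Q e+c-k≡c-[k-e]) (≡.sym (rev-≤ Q (ℕₚ.m≤n+o⇒m∸n≤o k e k≤e+c))))
    where
    e+c-k≡c-[k-e] : e + c ∸ k ≡ c ∸ (k ∸ e)
    e+c-k≡c-[k-e] = ≡.trans (≡.cong (e + c ∸_) (≡.sym (ℕₚ.m+[n∸m]≡n e≤k))) (ℕₚ.[m+n]∸[m+o]≡n∸o e c (k ∸ e))
  ... | yes _     | no e≰k  = Q≈0 (e + c ∸ k)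
    (≡.subst (_< e + c ∸ k) (ℕₚ.m+n∸m≡n e c) (ℕₚ.∸-monoʳ-< (ℕₚ.≰⇒> e≰k) (ℕₚ.m≤m+n e c)))
  ... | no k≰e+c  | yes _   = reflexive (≡.sym (rev-> Q
    (ℕₚ.m+n≤o⇒m≤o∸n (suc c) (≡.subst (_≤ k) (≡.cong suc (ℕₚ.+-comm e c)) (ℕₚ.≰⇒> k≰e+c)))))
  ... | no _      | no _    = refl

  rev-conv : ∀ (P Q : Series) a b → (∀ i → a < i → P i ≈ 0#) → (∀ i → b < i → Q i ≈ 0#) →
             ∀ k → conv (rev P a) (rev Q b) k ≈ rev (conv P Q) (a + b) k
  rev-conv P Q a b P≈0 Q≈0 k = begin
    conv (rev P a) (rev Q b) k
      ≈⟨ conv-by-shifts (suc a) (rev P a) (rev Q b) (λ i a<i → reflexive (rev-> P a<i)) k ⟩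
    sumUpTo (suc a) (λ i → rev P a i · shift i (rev Q b) k)
      ≈⟨ sum-reverse (suc a) _ ⟩
    sumUpTo (suc a) (λ i → rev P a (a ∸ i) · shift (a ∸ i) (rev Q b) k)
      ≈⟨ sum-cong< (suc a) (λ i i<1+a → *-cong (reflexive (rev-P (ℕₚ.≤-pred i<1+a))) (sym (shifted-rev (ℕₚ.≤-pred i<1+a)))) ⟩
    sumUpTo (suc a) (λ i → P i · rev (shift i Q) (a + b) k)
      ≈⟨ rev-sum (suc a) P (λ i → shift i Q) (a + b) k ⟨
    rev (λ j → sumUpTo (suc a) (λ i → P i · shift i Q j)) (a + b) k
      ≈⟨ rev-cong (a + b) (conv-by-shifts (suc a) P Q P≈0) k ⟨
    rev (conv P Q) (a + b) k ∎
    where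
    rev-P : ∀ {i} → i ≤ a → rev P a (a ∸ i) ≡ P i
    rev-P {i} i≤a = ≡.trans (rev-≤ P (ℕₚ.m∸n≤m a i)) (≡.cong P (ℕₚ.m∸[m∸n]≡n i≤a))
    shifted-rev : ∀ {i} → i ≤ a → rev (shift i Q) (a + b) k ≈ shift (a ∸ i) (rev Q b) k
    shifted-rev {i} i≤a = begin
      rev (shift i Q) (a + b) k                      ≡⟨ ≡.cong (λ n → rev (shift i Q) n k) a+b≡[a-i]+[i+b] ⟩
      rev (shift i Q) (a ∸ i + (i + b)) k            ≈⟨ rev-pad (a ∸ i) (i + b) (shift i Q) (shift-vanish i Q Q≈0) k ⟩
      shift (a ∸ i) (rev (shift i Q) (i + b)) k      ≈⟨ shift-cong (a ∸ i) (rev-shift i b Q) k ⟩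
      shift (a ∸ i) (rev Q b) k                      ∎
      where
      a+b≡[a-i]+[i+b] : a + b ≡ a ∸ i + (i + b)
      a+b≡[a-i]+[i+b] = ≡.trans (≡.cong (_+ b) (≡.sym (ℕₚ.m∸n+n≡m i≤a))) (ℕₚ.+-assoc (a ∸ i) i b)

  conv-rev-coefficient : ∀ (P X : Series) a l → conv (rev P a) X (a + l) ≈ sumUpTo (suc a) (λ i → P i · X (i + l))
  conv-rev-coefficient P X a l = begin
    conv (rev P a) X (a + l)
      ≈⟨ conv-by-shifts (suc a) (rev P a) X (λ i a<i → reflexive (rev-> P a<i)) (a + l) ⟩
    sumUpTo (suc a) (λ i → rev P a i · shift i X (a + l))
      ≈⟨ sum-reverse (suc a) _ ⟩
    sumUpTo (suc a) (λ i → rev P a (a ∸ i) · shift (a ∸ i) X (a + l))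
      ≈⟨ sum-cong< (suc a) (λ i i<1+a → reflexive (coefficient (ℕₚ.≤-pred i<1+a))) ⟩
    sumUpTo (suc a) (λ i → P i · X (i + l)) ∎
    where
    coefficient : ∀ {i} → i ≤ a → rev P a (a ∸ i) · shift (a ∸ i) X (a + l) ≡ P i · X (i + l)
    coefficient {i} i≤a = ≡.cong₂ _·_
      (≡.trans (rev-≤ P (ℕₚ.m∸n≤m a i)) (≡.cong P (ℕₚ.m∸[m∸n]≡n i≤a)))
      (≡.trans (shift-≥ X (ℕₚ.≤-trans (ℕₚ.m∸n≤m a i) (ℕₚ.m≤m+n a l))) (≡.cong X (m+o∸[m∸n]≡n+o l i≤a)))

  conv-vanish : ∀ {P Q : Series} {a b} → (∀ i → a < i → P i ≈ 0#) → (∀ i → b < i → Q i ≈ 0#) →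
                ∀ k → a + b < k → conv P Q k ≈ 0#
  conv-vanish {P} {Q} {a} {b} P≈0 Q≈0 k a+b<k = sum-zero (suc k) term≈0
    where
    term≈0 : ∀ j → j < suc k → P j · Q (k ∸ j) ≈ 0#
    term≈0 j _ with a <? j
    ... | yes a<j = trans (*-congʳ (P≈0 j a<j)) (zeroˡ _)
    ... | no  a≮j = trans (*-congˡ (Q≈0 (k ∸ j) (ℕₚ.m+n≤o⇒m≤o∸n (suc b) (ℕₚ.≤-trans 1+b+j≤1+b+a 1+b+a≤k)))) (zeroʳ _)
      where
      1+b+j≤1+b+a : suc b + j ≤ suc b + a
      1+b+j≤1+b+a = ℕₚ.+-monoʳ-≤ (suc b) (ℕₚ.≮⇒≥ a≮j)
      1+b+a≤k : suc b + a ≤ k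
      1+b+a≤k = ≡.subst (_≤ k) (≡.cong suc (ℕₚ.+-comm a b)) a+b<k

  conv-top : ∀ {P Q : Series} {a b} → (∀ i → a < i → P i ≈ 0#) → (∀ i → b < i → Q i ≈ 0#) →
             conv P Q (a + b) ≈ P a · Q b
  conv-top {P} {Q} {a} {b} P≈0 Q≈0 =
    trans (sum-single (suc (a + b)) _ a (s≤s (ℕₚ.m≤m+n a b)) others≈0) (*-congˡ (reflexive (≡.cong Q (ℕₚ.m+n∸m≡n a b))))
    where
    others≈0 : ∀ j → j < suc (a + b) → j ≢ a → P j · Q (a + b ∸ j) ≈ 0#
    others≈0 j _ j≢a with ℕₚ.<-cmp j a
    ... | tri< j<a _ _ = trans (*-congˡ (Q≈0 _ (≡.subst (_< a + b ∸ j) (ℕₚ.m+n∸m≡n a b) (ℕₚ.∸-monoʳ-< j<a (ℕₚ.m≤m+n a b))))) (zeroʳ _)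
    ... | tri≈ _ j≡a _ = ⊥-elim (j≢a j≡a)
    ... | tri> _ _ a<j = trans (*-congʳ (P≈0 j a<j)) (zeroˡ _)

  conv-first : ∀ {Z : Series} U K → (∀ k → k < K → Z k ≈ 0#) → conv Z U K ≈ Z K · U 0
  conv-first {Z} U K Z≈0 = begin
    sumUpTo K (λ i → Z i · U (K ∸ i)) ⊕ Z K · U (K ∸ K)   ≈⟨ +-cong (sum-zero K λ i i<K → trans (*-congʳ (Z≈0 i i<K)) (zeroˡ _))
                                                                    (*-congˡ (reflexive (≡.cong U (ℕₚ.n∸n≡0 K)))) ⟩
    0# ⊕ Z K · U 0                                        ≈⟨ +-identityˡ _ ⟩
    Z K · U 0                                             ∎

  -- Generalized Sturm sequences

  -- IsSturmSeries f d m i S says that S is the series S_{f_i,f_{i+1}}.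
  IsSturmSeries : (f : ℕ → ℕ → Carrier) (d m : ℕ → ℕ) → ℕ → Series → Set ℓ₂
  IsSturmSeries f d m i S =
    ∀ k → conv S (rev (f i) (d i)) k ≈ shift (m i ∸ 1) (rev (f (suc i)) (d (suc i))) k

  module SturmLevel {s f d B m} (sturm : IsGenSturm s f d B m) {i} (i<s : i < s) where
    open IsGenSturm sturm

    B-vanish : ∀ k → m i < k → B i k ≈ 0#
    B-vanish = proj₂ (B-deg i i<s)

    b≉0 : B i (m i) ≉ 0#
    b≉0 = proj₁ (B-deg i i<s)

    f₁-vanish : ∀ k → d (suc i) < k → f (suc i) k ≈ 0#
    f₁-vanish = proj₂ (f-deg (suc i) i<s)

    f₁-leading-coefficient≉0 : f (suc i) (d (suc i)) ≉ 0#
    f₁-leading-coefficient≉0 = proj₁ (f-deg (suc i) i<s)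

    f₂-vanish : ∀ k → d (suc i) ≤ k → f (suc (suc i)) k ≈ 0#
    f₂-vanish k d₁≤k with suc i ≟ s
    ... | yes ≡.refl = f-last k
    ... | no 1+i≢s   = proj₂ (f-deg (suc (suc i)) 1+i<s) k (ℕₚ.<-≤-trans (deg-dec (suc i) 1+i<s) d₁≤k)
      where
      1+i<s : suc i < s
      1+i<s = ℕₚ.≤∧≢⇒< i<s 1+i≢s

    f₀≈B·f₁ : ∀ k → d (suc i) ≤ k → f i k ≈ conv (B i) (f (suc i)) k
    f₀≈B·f₁ k d₁≤k = begin
      f i k                                                   ≈⟨ recur i i<s k ⟩
      conv (B i) (f (suc i)) k ⊖ f (suc (suc i)) k            ≈⟨ +-congˡ (trans (-‿cong (f₂-vanish k d₁≤k)) ε⁻¹≈ε) ⟩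
      conv (B i) (f (suc i)) k ⊕ 0#                           ≈⟨ +-identityʳ _ ⟩
      conv (B i) (f (suc i)) k                                ∎

    B·f₁≈f₀+f₂ : ∀ k → conv (B i) (f (suc i)) k ≈ f i k ⊕ f (suc (suc i)) k
    B·f₁≈f₀+f₂ k = begin
      conv (B i) (f (suc i)) k                                         ≈⟨ +-identityʳ _ ⟨
      conv (B i) (f (suc i)) k ⊕ 0#                                    ≈⟨ +-congˡ (-‿inverseˡ _) ⟨
      conv (B i) (f (suc i)) k ⊕ (- f (suc (suc i)) k ⊕ f (suc (suc i)) k) ≈⟨ +-assoc _ _ _ ⟨
      (conv (B i) (f (suc i)) k ⊖ f (suc (suc i)) k) ⊕ f (suc (suc i)) k ≈⟨ +-congʳ (recur i i<s k) ⟨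
      f i k ⊕ f (suc (suc i)) k                                        ∎

    f₀-top : f i (m i + d (suc i)) ≈ B i (m i) · f (suc i) (d (suc i))
    f₀-top = trans (f₀≈B·f₁ _ (ℕₚ.m≤n+m _ (m i))) (conv-top B-vanish f₁-vanish)

    d-step : d i ≡ m i + d (suc i)
    d-step with ℕₚ.<-cmp (d i) (m i + d (suc i))
    ... | tri< dᵢ<m+d₁ _ _ = ⊥-elim (·-nonZero b≉0 f₁-leading-coefficient≉0 (trans (sym f₀-top) (proj₂ (f-deg i (ℕₚ.<⇒≤ i<s)) _ dᵢ<m+d₁)))
    ... | tri≈ _ dᵢ≡m+d₁ _ = dᵢ≡m+d₁
    ... | tri> _ _ m+d₁<dᵢ = ⊥-elim (proj₁ (f-deg i (ℕₚ.<⇒≤ i<s))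
            (trans (f₀≈B·f₁ (d i) (ℕₚ.≤-trans (ℕₚ.m≤n+m _ (m i)) (ℕₚ.<⇒≤ m+d₁<dᵢ)))
                   (conv-vanish B-vanish f₁-vanish (d i) m+d₁<dᵢ)))

    0<m : 0 < m i
    0<m with m i | d-step
    ... | zero  | dᵢ≡d₁ = ⊥-elim (ℕₚ.<-irrefl (≡.sym dᵢ≡d₁) (deg-dec i i<s))
    ... | suc _ | _     = s≤s z≤n

    f₀-leading-coefficient : f i (d i) ≈ B i (m i) · f (suc i) (d (suc i))
    f₀-leading-coefficient = trans (reflexive (≡.cong (f i) d-step)) f₀-top

    rev-f₀-0≉0 : rev (f i) (d i) 0 ≉ 0#
    rev-f₀-0≉0 = proj₁ (f-deg i (ℕₚ.<⇒≤ i<s)) ∘ trans (reflexive (≡.sym (rev-≤ (f i) z≤n)))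

    sturmSeries-exists : ∃[ S ] IsSturmSeries f d m i S
    sturmSeries-exists = divide (rev (f i) (d i)) (shift (m i ∸ 1) (rev (f (suc i)) (d (suc i)))) rev-f₀-0≉0

    sturmSeries-low : ∀ {S} → IsSturmSeries f d m i S → ∀ k → k < m i ∸ 1 → S k ≈ 0#
    sturmSeries-low {S} S-series = conv-cancelʳ {S} {λ _ → 0#} {rev (f i) (d i)} (m i ∸ 1) rev-f₀-0≉0 λ k k<m-1 → begin
      conv S (rev (f i) (d i)) k                               ≈⟨ S-series k ⟩
      shift (m i ∸ 1) (rev (f (suc i)) (d (suc i))) k          ≡⟨ shift-< (rev (f (suc i)) (d (suc i))) k<m-1 ⟩
      0#                                                       ≈⟨ sum-zero (suc k) (λ _ _ → zeroˡ _) ⟨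
      conv (λ _ → 0#) (rev (f i) (d i)) k                      ∎

    sturmSeries-leading : ∀ {S} → IsSturmSeries f d m i S → S (m i ∸ 1) · B i (m i) ≈ 1#
    sturmSeries-leading {S} S-series = ·-cancelʳ f₁-leading-coefficient≉0 (begin
      (S (m i ∸ 1) · B i (m i)) · f (suc i) (d (suc i))        ≈⟨ *-assoc _ _ _ ⟩
      S (m i ∸ 1) · (B i (m i) · f (suc i) (d (suc i)))
        ≈⟨ *-congˡ (trans (sym f₀-leading-coefficient) (reflexive (≡.sym (rev-≤ (f i) z≤n)))) ⟩
      S (m i ∸ 1) · rev (f i) (d i) 0                          ≈⟨ conv-first (rev (f i) (d i)) (m i ∸ 1) (sturmSeries-low S-series) ⟨
      conv S (rev (f i) (d i)) (m i ∸ 1)                       ≈⟨ S-series (m i ∸ 1) ⟩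
      shift (m i ∸ 1) (rev (f (suc i)) (d (suc i))) (m i ∸ 1)  ≡⟨ shift-≥ (rev (f (suc i)) (d (suc i))) (ℕₚ.≤-refl {m i ∸ 1}) ⟩
      rev (f (suc i)) (d (suc i)) (m i ∸ 1 ∸ (m i ∸ 1))        ≡⟨ ≡.cong (rev (f (suc i)) (d (suc i))) (ℕₚ.n∸n≡0 (m i ∸ 1)) ⟩
      rev (f (suc i)) (d (suc i)) 0                            ≡⟨ rev-≤ (f (suc i)) z≤n ⟩
      f (suc i) (d (suc i))                                    ≈⟨ *-identityˡ _ ⟨
      1# · f (suc i) (d (suc i))                               ∎)

  module SturmStep {s f d B m} (sturm : IsGenSturm s f d B m) {i} (1+i<s : suc i < s)
                   {S T : Series} (S-series : IsSturmSeries f d m i S) (T-series : IsSturmSeries f d m (suc i) T)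
                   where
    open IsGenSturm sturm
    private
      module L₀ = SturmLevel sturm (ℕₚ.<-trans (ℕₚ.n<1+n i) 1+i<s)
      module L₁ = SturmLevel sturm 1+i<s
      A  = rev (f i) (d i)
      Q  = rev (f (suc i)) (d (suc i))
      R  = rev (f (suc (suc i))) (d (suc (suc i)))
      RB = rev (B i) (m i)
      e  = m i
      e′ = m (suc i)

    rev-division : ∀ k → conv RB Q k ≈ A k ⊕ shift (e + e′) R k
    rev-division k = begin
      conv RB Q k
        ≈⟨ rev-conv (B i) (f (suc i)) e (d (suc i)) L₀.B-vanish L₀.f₁-vanish k ⟩
      rev (conv (B i) (f (suc i))) (e + d (suc i)) k
        ≡⟨ ≡.cong (λ n → rev (conv (B i) (f (suc i))) n k) L₀.d-step ⟨
      rev (conv (B i) (f (suc i))) (d i) k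
        ≈⟨ rev-cong (d i) L₀.B·f₁≈f₀+f₂ k ⟩
      rev (λ j → f i j ⊕ f (suc (suc i)) j) (d i) k
        ≈⟨ rev-⊕ (f i) (f (suc (suc i))) (d i) k ⟩
      A k ⊕ rev (f (suc (suc i))) (d i) k
        ≡⟨ ≡.cong (λ n → A k ⊕ rev (f (suc (suc i))) n k) dᵢ≡e+e′+d₂ ⟩
      A k ⊕ rev (f (suc (suc i))) (e + e′ + d (suc (suc i))) k
        ≈⟨ +-congˡ (rev-pad (e + e′) (d (suc (suc i))) (f (suc (suc i))) (proj₂ (f-deg (suc (suc i)) 1+i<s)) k) ⟩
      A k ⊕ shift (e + e′) R k ∎
      where
      dᵢ≡e+e′+d₂ : d i ≡ e + e′ + d (suc (suc i))
      dᵢ≡e+e′+d₂ = ≡.trans L₀.d-step (≡.trans (≡.cong (e +_) L₁.d-step) (≡.sym (ℕₚ.+-assoc e e′ _)))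

    private
      RB·S·Q : ∀ k → conv (conv RB S) Q k ≈ shift (e ∸ 1) Q k ⊕ shift (e + e′) (conv S R) k
      RB·S·Q k = begin
        conv (conv RB S) Q k                          ≈⟨ conv-congˡ Q (conv-comm RB S) k ⟩
        conv (conv S RB) Q k                          ≈⟨ conv-assoc S RB Q k ⟩
        conv S (conv RB Q) k                          ≈⟨ conv-congʳ S rev-division k ⟩
        conv S (λ j → A j ⊕ shift (e + e′) R j) k     ≈⟨ conv-distribˡ-⊕ S A (shift (e + e′) R) k ⟩
        conv S A k ⊕ conv S (shift (e + e′) R) k      ≈⟨ +-cong (S-series k) (conv-shift S R (e + e′) k) ⟩
        shift (e ∸ 1) Q k ⊕ shift (e + e′) (conv S R) k ∎

      Q·S·T : ∀ k → conv Q (conv S T) k ≈ shift (e′ ∸ 1) (conv S R) k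
      Q·S·T k = begin
        conv Q (conv S T) k              ≈⟨ conv-comm Q (conv S T) k ⟩
        conv (conv S T) Q k              ≈⟨ conv-assoc S T Q k ⟩
        conv S (conv T Q) k              ≈⟨ conv-congʳ S T-series k ⟩
        conv S (shift (e′ ∸ 1) R) k      ≈⟨ conv-shift S R (e′ ∸ 1) k ⟩
        shift (e′ ∸ 1) (conv S R) k      ∎

      expansion : Series
      expansion j = shift (e ∸ 1) one j ⊕ shift (suc e) (conv S T) j

      expansion·Q : ∀ k → conv expansion Q k ≈ shift (e ∸ 1) Q k ⊕ shift (e + e′) (conv S R) k
      expansion·Q k = begin
        conv expansion Q k
          ≈⟨ conv-comm expansion Q k ⟩
        conv Q expansion k
          ≈⟨ conv-distribˡ-⊕ Q (shift (e ∸ 1) one) (shift (suc e) (conv S T)) k ⟩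
        conv Q (shift (e ∸ 1) one) k ⊕ conv Q (shift (suc e) (conv S T)) k
          ≈⟨ +-cong (conv-shift Q one (e ∸ 1) k) (conv-shift Q (conv S T) (suc e) k) ⟩
        shift (e ∸ 1) (conv Q one) k ⊕ shift (suc e) (conv Q (conv S T)) k
          ≈⟨ +-cong (shift-cong (e ∸ 1) (conv-one Q) k) (shift-cong (suc e) Q·S·T k) ⟩
        shift (e ∸ 1) Q k ⊕ shift (suc e) (shift (e′ ∸ 1) (conv S R)) k
          ≈⟨ +-congˡ (shift-shift (suc e) (e′ ∸ 1) (conv S R) k) ⟩
        shift (e ∸ 1) Q k ⊕ shift (suc e + (e′ ∸ 1)) (conv S R) k
          ≡⟨ ≡.cong (λ n → shift (e ∸ 1) Q k ⊕ shift n (conv S R) k) (≡.sym (m+n≡1+m+[n∸1] e L₁.0<m)) ⟩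
        shift (e ∸ 1) Q k ⊕ shift (e + e′) (conv S R) k ∎

    -- rev B_i · S = x^(m_i−1) + x^(m_i+1)·S·T: both sides agree after multiplication by rev f_{i+1},
    -- whose constant term is invertible.
    RB·S≈expansion : ∀ k → conv RB S k ≈ shift (e ∸ 1) one k ⊕ shift (suc e) (conv S T) k
    RB·S≈expansion k = conv-cancelʳ {conv RB S} {expansion} {Q} (suc k) L₀.f₁-leading-coefficient≉0
      (λ j _ → trans (RB·S·Q j) (sym (expansion·Q j))) k ℕₚ.≤-refl

    sturm-recurrence : ∀ l → sumUpTo (suc e) (λ a → B i a · S (a + l)) ≈ sumUpTo l (λ u → T u · S (l ∸ 1 ∸ u))
    sturm-recurrence l = begin
      sumUpTo (suc e) (λ a → B i a · S (a + l))
        ≈⟨ conv-rev-coefficient (B i) S e l ⟨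
      conv RB S (e + l)
        ≈⟨ RB·S≈expansion (e + l) ⟩
      shift (e ∸ 1) one (e + l) ⊕ shift (suc e) (conv S T) (e + l)
        ≈⟨ +-congʳ one-part ⟩
      0# ⊕ shift (suc e) (conv S T) (e + l)
        ≈⟨ +-identityˡ _ ⟩
      shift (suc e) (conv S T) (e + l)
        ≈⟨ ST-part l ⟩
      sumUpTo l (λ u → T u · S (l ∸ 1 ∸ u)) ∎
      where
      one-part : shift (e ∸ 1) one (e + l) ≈ 0#
      one-part = reflexive (≡.trans (shift-≥ one (ℕₚ.≤-trans (ℕₚ.m∸n≤m e 1) (ℕₚ.m≤m+n e l)))
                                    (≡.cong one (≡.trans (≡.cong (_∸ (e ∸ 1)) (≡.sym ([m∸1]+1+n≡m+n l L₀.0<m))) (ℕₚ.m+n∸m≡n (e ∸ 1) (suc l)))))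
      ST-part : ∀ l → shift (suc e) (conv S T) (e + l) ≈ sumUpTo l (λ u → T u · S (l ∸ 1 ∸ u))
      ST-part zero     = reflexive (shift-< (conv S T) (s≤s (ℕₚ.≤-reflexive (ℕₚ.+-identityʳ e))))
      ST-part (suc l′) = begin
        shift (suc e) (conv S T) (e + suc l′)        ≡⟨ ≡.cong (shift (suc e) (conv S T)) (ℕₚ.+-suc e l′) ⟩
        shift (suc e) (conv S T) (suc e + l′)        ≡⟨ shift-≥ (conv S T) (ℕₚ.m≤m+n (suc e) l′) ⟩
        conv S T (suc e + l′ ∸ suc e)                ≡⟨ ≡.cong (conv S T) (ℕₚ.m+n∸m≡n (suc e) l′) ⟩
        conv S T l′                                  ≈⟨ conv-comm S T l′ ⟩
        conv T S l′                                  ∎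

  -- Iterating along the Sturm sequence

  IsGenSturm-tail : ∀ {s f d B m} → IsGenSturm (suc s) f d B m →
                    IsGenSturm s (f ∘ suc) (d ∘ suc) (B ∘ suc) (m ∘ suc)
  IsGenSturm-tail sturm = record
    { f-deg   = λ i i≤s → f-deg (suc i) (s≤s i≤s)
    ; f-last  = f-last
    ; deg-dec = λ i i<s → deg-dec (suc i) (s≤s i<s)
    ; B-deg   = λ i i<s → B-deg (suc i) (s≤s i<s)
    ; recur   = λ i i<s → recur (suc i) (s≤s i<s)
    }
    where open IsGenSturm sturm

  squaredLeadingProduct : (B : ℕ → ℕ → Carrier) (m : ℕ → ℕ) → ℕ → Carrier
  squaredLeadingProduct B m κ = prodUpTo κ (λ i → B i (m i) · B i (m i))

  record TailReduction (f : ℕ → ℕ → Carrier) (d : ℕ → ℕ) (B : ℕ → ℕ → Carrier) (m : ℕ → ℕ)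
                       (S : Series) (κ : ℕ) : Set (ℓ₁ ⊔ ℓ₂) where
    field
      tail        : Series
      tail-series : IsSturmSeries f d m κ tail
      hankel-tail : ∀ t → detℕ (sumℕ κ m + t) (Hankel S) · pow (squaredLeadingProduct B m κ) t
                          ≈ detℕ (sumℕ κ m) (Hankel S) · detℕ t (Hankel tail)

  hankel-step : ∀ {s f d B m} → IsGenSturm s f d B m → ∀ {i} → suc i < s →
                ∀ {S T} → IsSturmSeries f d m i S → IsSturmSeries f d m (suc i) T →
                ∀ n → detℕ (m i + n) (Hankel S) · pow (B i (m i) · B i (m i)) n
                      ≈ detℕ (m i) (Hankel S) · detℕ n (Hankel T)
  hankel-step {f = f} {d} {B} {m} sturm {i} 1+i<s {S} {T} S-series T-series n = begin
    H (m i + n) S · pow (b · b) n              ≈⟨ *-congˡ (pow-distrib-· b b n) ⟩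
    H (m i + n) S · (pow b n · pow b n)        ≈⟨ solve 3 (λ x p q → x :* (p :* q) := (p :* x) :* q) refl _ (pow b n) (pow b n) ⟩
    (pow b n · H (m i + n) S) · pow b n        ≈⟨ *-congʳ (hankel-reduction n) ⟩
    (H (m i) S · (pow c n · H n T)) · pow b n  ≈⟨ solve 4 (λ y p z q → (y :* (p :* z)) :* q := (y :* z) :* (p :* q)) refl _ (pow c n) _ (pow b n) ⟩
    (H (m i) S · H n T) · (pow c n · pow b n)  ≈⟨ *-congˡ (pow-inverse n (L.sturmSeries-leading S-series)) ⟩
    (H (m i) S · H n T) · 1#                   ≈⟨ *-identityʳ _ ⟩
    H (m i) S · H n T                          ∎
    where
    module L = SturmLevel sturm (ℕₚ.<-trans (ℕₚ.n<1+n i) 1+i<s)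
    open HankelReduction S T (B i) L.0<m (L.sturmSeries-low S-series) (SturmStep.sturm-recurrence sturm 1+i<s S-series T-series)
    H : ℕ → Series → Carrier
    H n X = detℕ n (Hankel X)
    b = B i (m i)
    c = S (m i ∸ 1)

  compose-reductions : ∀ {u x x₀ y p p₀ v w} a t → u ≉ 0# →
    x · pow u (a + t) ≈ y · p → x₀ · pow u a ≈ y · p₀ → p · v ≈ p₀ · w → x · (pow u t · v) ≈ x₀ · w
  compose-reductions {u} {x} {x₀} {y} {p} {p₀} {v} {w} a t u≉0 big small tail = ·-cancelʳ (pow-nonZero a u≉0) (begin
    (x · (pow u t · v)) · pow u a     ≈⟨ solve 4 (λ x q v r → (x :* (q :* v)) :* r := (x :* (r :* q)) :* v) refl x (pow u t) v (pow u a) ⟩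
    (x · (pow u a · pow u t)) · v     ≈⟨ *-congʳ (*-congˡ (pow-+ u a t)) ⟨
    (x · pow u (a + t)) · v           ≈⟨ *-congʳ big ⟩
    (y · p) · v                       ≈⟨ *-assoc y p v ⟩
    y · (p · v)                       ≈⟨ *-congˡ tail ⟩
    y · (p₀ · w)                      ≈⟨ *-assoc y p₀ w ⟨
    (y · p₀) · w                      ≈⟨ *-congʳ small ⟨
    (x₀ · pow u a) · w                ≈⟨ xy∙z≈xz∙y x₀ (pow u a) w ⟩
    (x₀ · w) · pow u a                ∎)

  tailReduction : ∀ κ {s f d B m} → IsGenSturm s f d B m → κ < s →
                  ∀ {S} → IsSturmSeries f d m 0 S → TailReduction f d B m S κ
  tailReduction zero _ _ {S} S-series = record
    { tail        = S
    ; tail-series = S-series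
    ; hankel-tail = λ t → trans (*-congˡ (pow-1# t)) (trans (*-identityʳ _) (sym (*-identityˡ _)))
    }
  tailReduction (suc κ) {suc s} {f} {d} {B} {m} sturm (s≤s κ<s) {S} S-series = record
    { tail        = tail
    ; tail-series = tail-series
    ; hankel-tail = λ t → begin
        detℕ (sumℕ (suc κ) m + t) (Hankel S) · pow (squaredLeadingProduct B m (suc κ)) t
          ≈⟨ *-cong (reflexive (≡.cong (λ n → detℕ n (Hankel S)) (≡.trans (≡.cong (_+ t) (sumℕ-head κ m)) (ℕₚ.+-assoc (m 0) r′ t))))
                    (trans (pow-cong t (prodUpTo-head κ _)) (pow-distrib-· _ _ t)) ⟩
        detℕ (m 0 + (r′ + t)) (Hankel S) · (pow (b₀ · b₀) t · pow Π′ t)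
          ≈⟨ compose-reductions r′ t (·-nonZero L₀.b≉0 L₀.b≉0) (step (r′ + t)) (step r′) (hankel-tail t) ⟩
        detℕ (m 0 + r′) (Hankel S) · detℕ t (Hankel tail)
          ≡⟨ ≡.cong (λ n → detℕ n (Hankel S) · detℕ t (Hankel tail)) (sumℕ-head κ m) ⟨
        detℕ (sumℕ (suc κ) m) (Hankel S) · detℕ t (Hankel tail) ∎
    }
    where
    1<1+s : 1 < suc s
    1<1+s = s≤s (ℕₚ.≤-<-trans z≤n κ<s)
    module L₀ = SturmLevel sturm (s≤s z≤n)
    T₁-exists : ∃[ T ] IsSturmSeries f d m 1 T
    T₁-exists = SturmLevel.sturmSeries-exists sturm 1<1+s
    T₁ : Series
    T₁ = proj₁ T₁-exists
    T₁-series : IsSturmSeries f d m 1 T₁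
    T₁-series = proj₂ T₁-exists
    open TailReduction (tailReduction κ (IsGenSturm-tail sturm) κ<s T₁-series)
    b₀ = B 0 (m 0)
    step : ∀ n → detℕ (m 0 + n) (Hankel S) · pow (b₀ · b₀) n ≈ detℕ (m 0) (Hankel S) · detℕ n (Hankel T₁)
    step = hankel-step sturm 1<1+s S-series T₁-series
    r′ = sumℕ κ (m ∘ suc)
    Π′ = squaredLeadingProduct (B ∘ suc) (m ∘ suc) κ

  module _ {s f d B m} (sturm : IsGenSturm s f d B m) {S} (S-series : IsSturmSeries f d m 0 S) {κ} (κ<s : κ < s) where
    private
      open TailReduction (tailReduction κ sturm κ<s S-series)
      module Lκ = SturmLevel sturm κ<s
      r = sumℕ κ m
      Π = squaredLeadingProduct B m κ
      Π≉0 : Π ≉ 0#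
      Π≉0 = prodUpTo-nonZero κ λ i i<κ → let module Li = SturmLevel sturm (ℕₚ.<-trans i<κ κ<s) in ·-nonZero Li.b≉0 Li.b≉0

    hankel-gap : ∀ t → r < t → t < r + m κ → hankel t S ≈ 0#
    hankel-gap t r<t t<r+m = begin
      hankel t S                     ≈⟨ hankel≈detℕ t S ⟩
      detℕ t (Hankel S)              ≡⟨ ≡.cong (λ n → detℕ n (Hankel S)) (ℕₚ.m+[n∸m]≡n (ℕₚ.<⇒≤ r<t)) ⟨
      detℕ (r + (t ∸ r)) (Hankel S)  ≈⟨ x·y≈0⇒x≈0 (pow-nonZero (t ∸ r) Π≉0) (begin
        detℕ (r + (t ∸ r)) (Hankel S) · pow Π (t ∸ r)    ≈⟨ hankel-tail (t ∸ r) ⟩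
        detℕ r (Hankel S) · detℕ (t ∸ r) (Hankel tail)   ≈⟨ *-congˡ (hankel-vanish tail (Lκ.sturmSeries-low tail-series)
                                                              (ℕₚ.m<n⇒0<n∸m r<t) t-r<m) ⟩
        detℕ r (Hankel S) · 0#                           ≈⟨ zeroʳ _ ⟩
        0#                                               ∎) ⟩
      0#                             ∎
      where
      t-r<m : t ∸ r < m κ
      t-r<m = ≡.subst (t ∸ r <_) (ℕₚ.m+n∸m≡n r (m κ)) (ℕₚ.∸-monoˡ-< t<r+m (ℕₚ.<⇒≤ r<t))

    hankel-jump : hankel (r + m κ) S ≈
                  pow (- 1#) ((m κ * (m κ ∸ 1)) / 2) · (pow ((B κ (m κ) · Π) ⁻¹) (m κ) · hankel r S)
    hankel-jump = begin
      hankel (r + e) S         ≈⟨ hankel≈detℕ (r + e) S ⟩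
      x                        ≈⟨ ·-cancelʳ (pow-nonZero e bΠ≉0) (trans x·[bΠ]ᵉ≈ε·h (sym rhs·[bΠ]ᵉ≈ε·h)) ⟩
      ε′ · (pow (bΠ ⁻¹) e · h) ≈⟨ *-congˡ (*-congˡ (sym (hankel≈detℕ r S))) ⟩
      ε′ · (pow (bΠ ⁻¹) e · hankel r S) ∎
      where
      e  = m κ
      b  = B κ e
      c  = tail (e ∸ 1)
      bΠ = b · Π
      x  = detℕ (r + e) (Hankel S)
      h  = detℕ r (Hankel S)
      ε  = reversalSign e
      ε′ = pow (- 1#) ((e * (e ∸ 1)) / 2)
      bΠ≉0 : bΠ ≉ 0#
      bΠ≉0 = ·-nonZero Lκ.b≉0 Π≉0
      x·[bΠ]ᵉ≈ε·h : x · pow bΠ e ≈ ε · h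
      x·[bΠ]ᵉ≈ε·h = begin
        x · pow bΠ e                          ≈⟨ *-congˡ (pow-distrib-· b Π e) ⟩
        x · (pow b e · pow Π e)               ≈⟨ solve 3 (λ x p q → x :* (p :* q) := (x :* q) :* p) refl x (pow b e) (pow Π e) ⟩
        (x · pow Π e) · pow b e               ≈⟨ *-congʳ (hankel-tail e) ⟩
        (h · detℕ e (Hankel tail)) · pow b e  ≈⟨ *-congʳ (*-congˡ (hankel-leading tail Lκ.0<m (Lκ.sturmSeries-low tail-series))) ⟩
        (h · (ε · pow c e)) · pow b e         ≈⟨ solve 4 (λ h ε p q → (h :* (ε :* p)) :* q := (ε :* h) :* (p :* q)) refl h ε (pow c e) (pow b e) ⟩
        (ε · h) · (pow c e · pow b e)         ≈⟨ *-congˡ (pow-inverse e (Lκ.sturmSeries-leading tail-series)) ⟩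
        (ε · h) · 1#                          ≈⟨ *-identityʳ _ ⟩
        ε · h                                 ∎
      rhs·[bΠ]ᵉ≈ε·h : (ε′ · (pow (bΠ ⁻¹) e · h)) · pow bΠ e ≈ ε · h
      rhs·[bΠ]ᵉ≈ε·h = begin
        (ε′ · (pow (bΠ ⁻¹) e · h)) · pow bΠ e
          ≈⟨ solve 4 (λ ε p h q → (ε :* (p :* h)) :* q := (ε :* h) :* (p :* q)) refl ε′ (pow (bΠ ⁻¹) e) h (pow bΠ e) ⟩
        (ε′ · h) · (pow (bΠ ⁻¹) e · pow bΠ e)   ≈⟨ *-congˡ (pow-inverse e (trans (*-comm _ _) (⁻¹-inverse bΠ bΠ≉0))) ⟩
        (ε′ · h) · 1#                           ≈⟨ *-identityʳ _ ⟩
        ε′ · h                                  ≈⟨ *-congʳ (reversalSign≈pow e) ⟨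
        ε · h                                   ∎

corollary2p4 : ∀ {c ℓ} (F : Field c ℓ) → let open FieldNotation F in
  (s : ℕ) (f : ℕ → ℕ → Carrier) (d : ℕ → ℕ) (B : ℕ → ℕ → Carrier) (m : ℕ → ℕ) →
  IsGenSturm s f d B m →
  (S : ℕ → Carrier) →
  (∀ k → conv S (rev (f 0) (d 0)) k ≈ shift (m 0 ∸ 1) (rev (f 1) (d 1)) k) →
  (κ : ℕ) → κ < s →
  ¬ (hankel (sumℕ κ m) S ≈ 0#) →
  (∀ t → sumℕ κ m < t → t < sumℕ κ m + m κ → hankel t S ≈ 0#)
  × (hankel (sumℕ κ m + m κ) S
      ≈ (pow (- 1#) ((m κ * (m κ ∸ 1)) / 2)
         · (pow ((B κ (m κ) · prodUpTo κ (λ i → B i (m i) · B i (m i))) ⁻¹) (m κ)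
            · hankel (sumℕ κ m) S)))
corollary2p4 F s f d B m sturm S S-series κ κ<s _ =
  OverField.hankel-gap F sturm S-series κ<s , OverField.hankel-jump F sturm S-series κ<s
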